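{- If $\lambda$ is a JS-partition of type $\alpha$, then its $p$-core is either empty or rectangular of the form $(l^a)$ with $l,a\in\mathbb{N}$ and $l-a\equiv\alpha\pmod p$. More precisely, represent $\alpha\in\{0,\dots,p-1\}$, let $R_p(\lambda)=\left\{\begin{smallmatrix}x_1&\cdots&x_m\\ y_1&\cdots&y_m\end{smallmatrix}\right\}$ and consider the last column $(x_m,y_m)$ (entries mod $p$). Then - $\lambda_{(p)}=(l^{p+l-\alpha})$ if $(x_m,y_m)\in\{(l-1,\alpha-l+1),(\alpha-l-1,l+1),(l,l+1),(\alpha-l,\alpha-l+1)\}$ with $1\le l\le\frac{\alpha}{2}$; - $\lambda_{(p)}=(l^{l-\alpha})$ if $(x_m,y_m)\in\{(l-1,\alpha-l+1),(\alpha-l-1,l+1),(l,l+1),(\alpha-l,\alpha-l+1)\}$ with $\alpha+1\le l<\frac{p+1+\alpha}{2}$; - $\lambda_{(p)}=\emptyset$ if $(x_m,y_m)\in\{(\alpha-1,1),(-1,\alpha+1),(0,1),(\alpha,\alpha+1)\}$.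
   Context: Fix an integer $p\ge 2$. A partition is written $\lambda=(l_1^{a_1},\dots,l_t^{a_t})$ with $l_1>\dots>l_t>0$, $a_i\ge1$; $(l^a)$ denotes the partition with $a$ parts all equal to $l$. It is $p$-regular if all $a_i\le p-1$. A $p$-regular $\lambda$ is a JS-partition if $l_i-l_{i+1}+a_i+a_{i+1}\equiv 0\pmod p$ for $1\le i<t$; its type is $l_1-a_1 \bmod p$. The $p$-core $\lambda_{(p)}$ is the partition obtained from $\lambda$ by repeatedly removing rim hooks of length $p$ until none can be removed (it is independent of choices). Residue symbol: the rim of $\lambda$ is the set of nodes $(i,j)$ of the Young diagram with $(i+1,j+1)$ not in it, ordered from the end of the first row to the start of the last row. The $p$-rim is the union of $p$-segments: the first consists of the first $p$ nodes of the rim (or all of it), each next one consists of the first $p$ (or all remaining) rim nodes starting at the last node of the row just below the lowest row of the previous segment, until the last row is reached. Let $a_1$ = size of the $p$-rim of $\lambda^{(1)}=\lambda$, $r_1$ = its number of parts; removing the $p$-rim gives $\lambda^{(2)}$; iterate until $\lambda^{(m+1)}=\emptyset$, defining $a_j,r_j$ for $\lambda^{(j)}$. The residue symbol $R_p(\lambda)$ has columns $(x_j,y_j)$, $j=1,\dots,m$, with $x_j\equiv a_{m+1-j}-r_{m+1-j}$, $y_j\equiv 1-r_{m+1-j}\pmod p$. -}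

module Defs where

open import Data.Nat using (ℕ; zero; suc; _+_; _∸_; _≤_; _<_; _≤ᵇ_; _≡ᵇ_; _⊔_)
open import Data.Integer as ℤ using (ℤ; +_)
open import Data.Integer.Divisibility as ℤD using ()
open import Data.Nat.Divisibility using (_∣_)
open import Data.Bool using (if_then_else_)
open import Data.List using (List; []; _∷_; _++_; map; upTo; take; drop; length;
  filterᵇ; dropWhileᵇ; foldr; reverse; replicate)
open import Data.Nat.ListAction using (sum)
open import Data.List.Membership.Propositional using (_∈_)
open import Data.List.Relation.Unary.All using (All)
open import Data.List.Relation.Unary.Linked using (Linked)
open import Data.Product public using (_×_; _,_; proj₁; proj₂; Σ; ∃)
open import Data.Sum using (_⊎_)
open import Data.Unit using (⊤)
open import Data.Empty using (⊥)
open import Function using (_⇔_)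
open import Relation.Nullary using (¬_)
open import Relation.Binary.PropositionalEquality using (_≡_)
open import Relation.Binary.Construct.Closure.ReflexiveTransitive using (Star)

Partition : Set
Partition = List ℕ

IsPartition : Partition → Set
IsPartition λ′ = Linked (λ a b → b ≤ a) λ′ × All (0 <_) λ′

part : Partition → ℕ → ℕ
part []       _       = 0
part (x ∷ _)  zero    = x
part (_ ∷ xs) (suc i) = part xs i

-- nodes (row , column), 0-indexed
Node : Set
Node = ℕ × ℕ

InDiag : Partition → Node → Set
InDiag λ′ (i , j) = j < part λ′ i

rect : ℕ → ℕ → Partition
rect l a = replicate a l

-- Grouped form (l_1^{a_1},...,l_t^{a_t}) : run-length encoding.

groups : Partition → List (ℕ × ℕ)
groups [] = []
groups (x ∷ xs) with groups xs
... | [] = (x , 1) ∷ []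
... | (y , a) ∷ rest =
  if x ≡ᵇ y then (y , suc a) ∷ rest else (x , 1) ∷ (y , a) ∷ rest

IsPRegular : ℕ → Partition → Set
IsPRegular p λ′ = All (λ g → proj₂ g < p) (groups λ′)

JSCond : ℕ → List (ℕ × ℕ) → Set
JSCond p [] = ⊤
JSCond p (_ ∷ []) = ⊤
JSCond p ((l , a) ∷ (l′ , a′) ∷ rest) =
  p ∣ ((l ∸ l′) + a + a′) × JSCond p ((l′ , a′) ∷ rest)

_≡_[mod_] : ℤ → ℤ → ℕ → Set
x ≡ y [mod p ] = (+ p) ℤD.∣ (x ℤ.- y)

IsJSOfType : ℕ → Partition → ℤ → Set
IsJSOfType p λ′ α with groups λ′
... | [] = ⊥
... | (l₁ , a₁) ∷ rest =
  IsPartition λ′ × IsPRegular p λ′ × JSCond p ((l₁ , a₁) ∷ rest)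
  × ((+ l₁ ℤ.- + a₁) ≡ α [mod p ])

-- The rim, ordered from the end of the first row to the start of the
-- last row: in row i the nodes (i , j) with j ≥ λ_{i+1} - 1, j decreasing.

rimFrom : ℕ → Partition → List Node
rimFrom i [] = []
rimFrom i (x ∷ xs) =
  map (λ k → (i , x ∸ 1 ∸ k)) (upTo (x ∸ (part xs 0 ∸ 1))) ++ rimFrom (suc i) xs

rim : Partition → List Node
rim = rimFrom 0

RemovesRimHook : ℕ → Partition → Partition → Set
RemovesRimHook p λ′ μ = IsPartition μ × Σ ℕ λ k →
  let S = take p (drop k (rim λ′)) in
  length S ≡ p ×
  (∀ n → InDiag μ n ⇔ (InDiag λ′ n × ¬ (n ∈ S)))

IsCoreOf : ℕ → Partition → Partition → Set
IsCoreOf p λ′ μ = Star (RemovesRimHook p) λ′ μ × (∀ ν → ¬ RemovesRimHook p μ ν)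

-- Each segment is the first p (or all
-- remaining) rim nodes; the next one starts at the first rim node of the
-- row just below the lowest row of the previous segment (= last node of
-- that row); stop once the last row is reached.  (Fuel = rim length; each
-- step consumes at least one node since p ≥ 1.)

pRimAux : ℕ → ℕ → List Node → List Node
pRimAux p zero ns = []
pRimAux p (suc f) [] = []
pRimAux p (suc f) (n ∷ ns) =
  let seg = take p (n ∷ ns)
      r   = foldr (λ x m → proj₁ x ⊔ m) 0 seg
      rest = dropWhileᵇ (λ x → proj₁ x ≤ᵇ r) (n ∷ ns)
  in seg ++ pRimAux p f rest

pRim : ℕ → Partition → List Node
pRim p λ′ = pRimAux p (length (rim λ′)) (rim λ′)

-- remove the p-rim: row i loses the p-rim nodes lying in row i
-- (these are the rightmost nodes of that row); drop empty rows.
removeNodesFrom : ℕ → List Node → Partition → Partition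
removeNodesFrom i S [] = []
removeNodesFrom i S (x ∷ xs) =
  (x ∸ length (filterᵇ (λ n → proj₁ n ≡ᵇ i) S)) ∷ removeNodesFrom (suc i) S xs

removePRim : ℕ → Partition → Partition
removePRim p λ′ = filterᵇ (λ x → 1 ≤ᵇ x) (removeNodesFrom 0 (pRim p λ′) λ′)

-- (a_j , r_j) for λ^(1) = λ, λ^(2), ..., λ^(m) (fuel = |λ|)
rimDataAux : ℕ → ℕ → Partition → List (ℕ × ℕ)
rimDataAux p zero λ′ = []
rimDataAux p (suc f) [] = []
rimDataAux p (suc f) (x ∷ xs) =
  (length (pRim p (x ∷ xs)) , length (x ∷ xs)) ∷ rimDataAux p f (removePRim p (x ∷ xs))

rimData : ℕ → Partition → List (ℕ × ℕ)
rimData p λ′ = rimDataAux p (sum λ′) λ′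

-- Residue symbol R_p(λ): list of columns (x_j , y_j), j = 1..m, with
-- integer representatives x_j = a_{m+1-j} - r_{m+1-j}, y_j = 1 - r_{m+1-j}
-- (entries are meaningful modulo p).
residueSymbol : ℕ → Partition → List (ℤ × ℤ)
residueSymbol p λ′ =
  reverse (map (λ ar → (+ proj₁ ar ℤ.- + proj₂ ar , + 1 ℤ.- + proj₂ ar)) (rimData p λ′))

_≈_[mod_] : ℤ × ℤ → ℤ × ℤ → ℕ → Set
(x , y) ≈ (x′ , y′) [mod p ] = (x ≡ x′ [mod p ]) × (y ≡ y′ [mod p ])

InSetL : ℕ → ℤ → ℤ → ℤ × ℤ → Set
InSetL p α l c =
     (c ≈ (l ℤ.- + 1 , α ℤ.- l ℤ.+ + 1) [mod p ])
  ⊎ (c ≈ (α ℤ.- l ℤ.- + 1 , l ℤ.+ + 1) [mod p ])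
  ⊎ (c ≈ (l , l ℤ.+ + 1) [mod p ])
  ⊎ (c ≈ (α ℤ.- l , α ℤ.- l ℤ.+ + 1) [mod p ])

{-# OPTIONS --safe #-}
-- A partition is encoded by its boundary word, read from the top right: `true` is a step down and
-- `false` a step left.  Swapping a `true` with the `false` p letters later removes a rim p-hook and
-- keeps the number of `true`s (beads) on each runner ρ, the positions ≡ ρ (mod p).  Such swaps sort
-- the word, pushing all beads to the end, and the sorted word depends only on the runner counts.
-- For a JS-partition with r rows, the JS condition lets each block of `true`s slide by a multiple of
-- p against the next one, so the counts are those of r consecutive beads ending on a runner
-- e ≡ -(α + r).  The sorted word is then a rectangle with sides p - max(s, e) and min(s, e), where
-- s = r mod p, too small to contain a p-hook: it is the p-core.  Finally y_m = 1 - r, and each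
-- option listed for the last column of R_p(λ) says that {s, e} ≡ {l - α, -l} (mod p).
module Submission where

open import Defs
open import Data.Bool using (Bool; true; false; T; _∧_; _∨_)
open import Data.Bool.Properties using (T-≡)
open import Data.Empty using (⊥-elim)
open import Data.Integer as ℤ using (ℤ; _⊖_) renaming (∣_∣ to abs)
import Data.Integer.Properties as ℤP
import Data.Integer.Tactic.RingSolver as ℤ-Solver
open import Data.List
  using (List; []; _∷_; _++_; _∷ʳ_; map; take; drop; length; replicate; reverse; last; upTo; applyUpTo; zipWith)
open import Data.List.Membership.Propositional using (_∈_)
open import Data.List.Membership.Propositional.Properties
  using (∈-map⁺; ∈-map⁻; ∈-++⁺ˡ; ∈-++⁺ʳ; ∈-++⁻; ∈-upTo⁺; ∈-upTo⁻)
open import Data.List.Properties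
  using (unfold-reverse; map-++; map-∘; length-map; length-++; length-replicate; length-applyUpTo; length-take;
         length-drop; take-map; drop-map; take++drop≡id; ++-assoc; ++-identityʳ)
open import Data.List.Relation.Unary.All using (All; []; _∷_)
open import Data.List.Relation.Unary.Linked as Linked using (Linked; []; [-]; _∷_)
open import Data.Maybe using (just)
open import Data.Maybe.Properties using (just-injective)
open import Data.Nat
  using (ℕ; zero; suc; _+_; _*_; _∸_; _≤_; _<_; z≤n; s≤s; _<?_; _≤?_; _≟_; _%_; _/_; _⊔_; _⊓_; _≤ᵇ_; _≡ᵇ_;
         NonZero; >-nonZero⁻¹)
open import Data.Nat.DivMod
  using (%-distribˡ-+; [m+n]%n≡m%n; [m+kn]%n≡m%n; %-remove-+ʳ; m<n⇒m%n≡m; m%n<n; m%n%n≡m%n; n%n≡0; m*n%n≡0;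
         m≡m%n+[m/n]*n; m/n≤m)
open import Data.Nat.Divisibility using (_∣_; m%n≡0⇒n∣m)
open import Data.Nat.ListAction using (sum)
open import Data.Nat.Properties
open import Data.Nat.Tactic.RingSolver using (solve-∀)
open import Data.Product using (_×_; _,_; proj₁; proj₂; ∃-syntax)
open import Data.Sum using (_⊎_; inj₁; inj₂; [_,_]′)
open import Function using (_⇔_; mk⇔; Equivalence; _∘_)
open import Relation.Binary.Construct.Closure.ReflexiveTransitive using (Star; ε; _◅_; gmap)
open import Relation.Binary.Construct.Closure.ReflexiveTransitive.Properties using (module StarReasoning)
open import Relation.Binary.PropositionalEquality
open import Relation.Nullary using (¬_; Dec; yes; no; does)
open import Relation.Nullary.Decidable using (dec-true; dec-false)

zeros : List Bool → ℕ
zeros []          = 0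
zeros (false ∷ w) = suc (zeros w)
zeros (true ∷ w)  = zeros w

infixr 5 _∷⁺_

_∷⁺_ : ℕ → Partition → Partition
zero  ∷⁺ _ = []
suc z ∷⁺ μ = suc z ∷ μ

shape : List Bool → Partition
shape []          = []
shape (false ∷ w) = shape w
shape (true ∷ w)  = zeros w ∷⁺ shape w

zeros≡0⇒shape≡[] : ∀ w → zeros w ≡ 0 → shape w ≡ []
zeros≡0⇒shape≡[] []         _ = refl
zeros≡0⇒shape≡[] (true ∷ w) e rewrite e = refl

shape-true : ∀ w {z} → zeros w ≡ suc z → shape (true ∷ w) ≡ suc z ∷ shape w
shape-true w e rewrite e = refl

head-shape≤zeros : ∀ w → part (shape w) 0 ≤ zeros w
head-shape≤zeros []          = z≤n
head-shape≤zeros (false ∷ w) = m≤n⇒m≤1+n (head-shape≤zeros w)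
head-shape≤zeros (true ∷ w) with zeros w
... | zero  = z≤n
... | suc _ = ≤-refl

Decreasing : Partition → Set
Decreasing = Linked (λ a b → b ≤ a)

decreasing-∷ : ∀ {z} xs → part xs 0 ≤ z → Decreasing xs → Decreasing (z ∷ xs)
decreasing-∷ []       _ _ = [-]
decreasing-∷ (_ ∷ _)  h l = h ∷ l

decreasing-head : ∀ {x} xs → Decreasing (x ∷ xs) → part xs 0 ≤ x
decreasing-head []      _       = z≤n
decreasing-head (_ ∷ _) (h ∷ _) = h

shape-decreasing : ∀ w → Decreasing (shape w)
shape-decreasing []          = []
shape-decreasing (false ∷ w) = shape-decreasing w
shape-decreasing (true ∷ w) with zeros w | head-shape≤zeros w
... | zero  | _ = []
... | suc _ | h = decreasing-∷ (shape w) h (shape-decreasing w)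

shape-positive : ∀ w → All (0 <_) (shape w)
shape-positive []          = []
shape-positive (false ∷ w) = shape-positive w
shape-positive (true ∷ w) with zeros w
... | zero  = []
... | suc _ = s≤s z≤n ∷ shape-positive w

shape-isPartition : ∀ w → IsPartition (shape w)
shape-isPartition w = shape-decreasing w , shape-positive w

zeros-++ : ∀ u w → zeros (u ++ w) ≡ zeros u + zeros w
zeros-++ []          w = refl
zeros-++ (false ∷ u) w = cong suc (zeros-++ u w)
zeros-++ (true ∷ u)  w = zeros-++ u w

zeros-++-false : ∀ u w → zeros (u ++ false ∷ w) ≡ suc (zeros u + zeros w)
zeros-++-false u w = trans (zeros-++ u (false ∷ w)) (+-suc (zeros u) (zeros w))

zeros-falses : ∀ m → zeros (replicate m false) ≡ m
zeros-falses zero    = refl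
zeros-falses (suc m) = cong suc (zeros-falses m)

zeros-falses-++ : ∀ m w → zeros (replicate m false ++ w) ≡ m + zeros w
zeros-falses-++ zero    w = refl
zeros-falses-++ (suc m) w = cong suc (zeros-falses-++ m w)

zeros-trues : ∀ t → zeros (replicate t true) ≡ 0
zeros-trues zero    = refl
zeros-trues (suc t) = zeros-trues t

zeros-trues-++ : ∀ m w → zeros (replicate m true ++ w) ≡ zeros w
zeros-trues-++ zero    w = refl
zeros-trues-++ (suc m) w = zeros-trues-++ m w

zeros-true-false : ∀ A B C → zeros (A ++ true ∷ B ++ false ∷ C) ≡ suc (zeros A + (zeros B + zeros C))
zeros-true-false A B C = trans (zeros-++ A (true ∷ B ++ false ∷ C))
  (trans (cong (zeros A +_) (zeros-++-false B C)) (+-suc (zeros A) _))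

zeros-false-true : ∀ A B C → zeros (A ++ false ∷ B ++ true ∷ C) ≡ suc (zeros A + (zeros B + zeros C))
zeros-false-true A B C =
  trans (zeros-++-false A (B ++ true ∷ C)) (cong (λ t → suc (zeros A + t)) (zeros-++ B (true ∷ C)))

shape-falses : ∀ m → shape (replicate m false) ≡ []
shape-falses zero    = refl
shape-falses (suc m) = shape-falses m

shape-falses-++ : ∀ m w → shape (replicate m false ++ w) ≡ shape w
shape-falses-++ zero    w = refl
shape-falses-++ (suc m) w = shape-falses-++ m w

shape-trues : ∀ t → shape (replicate t true) ≡ []
shape-trues t = zeros≡0⇒shape≡[] (replicate t true) (zeros-trues t)

falses-∷ : ∀ m (w : List Bool) → replicate m false ++ false ∷ w ≡ false ∷ replicate m false ++ w
falses-∷ zero    w = refl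
falses-∷ (suc m) w = cong (false ∷_) (falses-∷ m w)

ones : List Bool → ℕ
ones []          = 0
ones (true ∷ w)  = suc (ones w)
ones (false ∷ w) = ones w

ones-falses : ∀ m → ones (replicate m false) ≡ 0
ones-falses zero    = refl
ones-falses (suc m) = ones-falses m

ones-falses-++ : ∀ m w → ones (replicate m false ++ w) ≡ ones w
ones-falses-++ zero    w = refl
ones-falses-++ (suc m) w = ones-falses-++ m w

ones-trues-++ : ∀ m w → ones (replicate m true ++ w) ≡ m + ones w
ones-trues-++ zero    w = refl
ones-trues-++ (suc m) w = cong suc (ones-trues-++ m w)

length≡ones+zeros : ∀ w → length w ≡ ones w + zeros w
length≡ones+zeros []          = refl
length≡ones+zeros (true ∷ w)  = cong suc (length≡ones+zeros w)
length≡ones+zeros (false ∷ w) = trans (cong suc (length≡ones+zeros w)) (sym (+-suc (ones w) (zeros w)))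

groupsWord : List (ℕ × ℕ) → List Bool
groupsWord []                       = []
groupsWord ((l , a) ∷ [])           = replicate a true ++ replicate l false
groupsWord ((l , a) ∷ (l′ , a′) ∷ G) = replicate a true ++ replicate (l ∸ l′) false ++ groupsWord ((l′ , a′) ∷ G)

groupsWord-suc : ∀ l a G → groupsWord ((l , suc a) ∷ G) ≡ true ∷ groupsWord ((l , a) ∷ G)
groupsWord-suc l a []      = refl
groupsWord-suc l a (_ ∷ _) = refl

headPart : List (ℕ × ℕ) → ℕ
headPart []            = 0
headPart ((l , _) ∷ _) = l

headMultiplicity : List (ℕ × ℕ) → ℕ
headMultiplicity []            = 0
headMultiplicity ((_ , a) ∷ _) = a

headPart-groups : ∀ xs → headPart (groups xs) ≡ part xs 0
headPart-groups []       = refl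
headPart-groups (x ∷ xs) with groups xs
... | []            = refl
... | (y , a) ∷ _ with x ≡ᵇ y in x≡y
...   | true  = sym (≡ᵇ⇒≡ x y (subst T (sym x≡y) _))
...   | false = refl

isJS⇒isPartition : ∀ {p λ′ α} → IsJSOfType p λ′ α → IsPartition λ′
isJS⇒isPartition {λ′ = λ′} js with groups λ′ | js
... | _ ∷ _ | isPart , _ = isPart

1≤headPart : ∀ xs {l a G} → groups xs ≡ (l , a) ∷ G → All (0 <_) xs → 1 ≤ l
1≤headPart (x ∷ xs) groups≡ (0<x ∷ _) = subst (1 ≤_) (trans (sym (headPart-groups (x ∷ xs))) (cong headPart groups≡)) 0<x

groupsWord-groups : ∀ xs → IsPartition xs →
  shape (groupsWord (groups xs)) ≡ xs × zeros (groupsWord (groups xs)) ≡ part xs 0 × ones (groupsWord (groups xs)) ≡ length xs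
groupsWord-groups []           _ = refl , refl , refl
groupsWord-groups (suc x ∷ xs) (dec , (s≤s z≤n ∷ pos))
  with groups xs | groupsWord-groups xs (Linked.tail dec , pos) | headPart-groups xs
... | [] | refl , _ , _ | _
  rewrite zeros-falses x = cong (suc x ∷_) (shape-falses x) , refl , cong suc (ones-falses x)
... | (y , a) ∷ G | shape≡ , zeros≡ , ones≡ | y≡ with suc x ≡ᵇ y in x≡y
...   | true
  rewrite groupsWord-suc y a G | zeros≡ | shape≡ | ones≡ | sym y≡ | sym (≡ᵇ⇒≡ (suc x) y (subst T (sym x≡y) _))
  = refl , refl , refl
...   | false
  rewrite zeros-falses-++ (suc x ∸ y) (groupsWord ((y , a) ∷ G)) | shape-falses-++ (suc x ∸ y) (groupsWord ((y , a) ∷ G))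
        | ones-falses-++ (suc x ∸ y) (groupsWord ((y , a) ∷ G)) | zeros≡ | shape≡ | ones≡
        | trans (cong (λ t → suc x ∸ t + part xs 0) y≡) (m∸n+n≡m (decreasing-head xs dec))
  = refl , refl , refl

-- Rim hooks

take-++-≤ : ∀ {A : Set} n (xs ys : List A) → n ≤ length xs → take n (xs ++ ys) ≡ take n xs
take-++-≤ zero    xs       ys _       = refl
take-++-≤ (suc n) (x ∷ xs) ys (s≤s h) = cong (x ∷_) (take-++-≤ n xs ys h)

take-++-length : ∀ {A : Set} {c} n (xs ys : List A) → length xs ≡ c → take (c + n) (xs ++ ys) ≡ xs ++ take n ys
take-++-length n []       ys refl = refl
take-++-length n (x ∷ xs) ys refl = cong (x ∷_) (take-++-length n xs ys refl)

drop-++-length : ∀ {A : Set} {c} n (xs ys : List A) → length xs ≡ c → drop (c + n) (xs ++ ys) ≡ drop n ys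
drop-++-length n []       ys refl = refl
drop-++-length n (x ∷ xs) ys refl = drop-++-length n xs ys refl

take-applyUpTo : ∀ {A : Set} (f : ℕ → A) {n c} → n ≤ c → take n (applyUpTo f c) ≡ applyUpTo f n
take-applyUpTo f {zero}              _       = refl
take-applyUpTo f {suc n} {suc c} (s≤s h) = cong (f 0 ∷_) (take-applyUpTo (f ∘ suc) h)

down : Node → Node
down (i , j) = (suc i , j)

topRimRow : ℕ → ℕ → List Node
topRimRow x c = map (λ k → (0 , x ∸ 1 ∸ k)) (upTo c)

rimFrom-suc : ∀ i μ → rimFrom (suc i) μ ≡ map down (rimFrom i μ)
rimFrom-suc i []       = refl
rimFrom-suc i (x ∷ μ) = begin
  map (λ k → (suc i , x ∸ 1 ∸ k)) ks ++ rimFrom (suc (suc i)) μ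
    ≡⟨ cong₂ _++_ (map-∘ ks) (rimFrom-suc (suc i) μ) ⟩
  map down (map (λ k → (i , x ∸ 1 ∸ k)) ks) ++ map down (rimFrom (suc i) μ)
    ≡⟨ map-++ down _ (rimFrom (suc i) μ) ⟨
  map down (rimFrom i (x ∷ μ)) ∎
  where
  open ≡-Reasoning
  ks = upTo (x ∸ (part μ 0 ∸ 1))

rim-∷ : ∀ x μ → rim (x ∷ μ) ≡ topRimRow x (x ∸ (part μ 0 ∸ 1)) ++ map down (rim μ)
rim-∷ x μ = cong (topRimRow x (x ∸ (part μ 0 ∸ 1)) ++_) (rimFrom-suc 0 μ)

length-topRimRow : ∀ x c → length (topRimRow x c) ≡ c
length-topRimRow x c = trans (length-map _ (upTo c)) (length-applyUpTo (λ k → k) c)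

topRimRow-row : ∀ {x c i j} → (i , j) ∈ topRimRow x c → i ≡ 0
topRimRow-row m with ∈-map⁻ _ m
... | _ , _ , refl = refl

∈-topRimRow⁻ : ∀ {x c j} → c ≤ x → (0 , j) ∈ topRimRow x c → x ∸ c ≤ j
∈-topRimRow⁻ {x} c≤x m with ∈-map⁻ _ m
... | k , k<c , refl = ≤-trans (∸-monoʳ-≤ x (∈-upTo⁻ k<c)) (≤-reflexive (sym (∸-+-assoc x 1 k)))

∈-topRimRow⁺ : ∀ {x c j} → c ≤ x → x ∸ c ≤ j → j < x → (0 , j) ∈ topRimRow x c
∈-topRimRow⁺ {suc x} {c} {j} c≤x x∸c≤j (s≤s j≤x) =
  subst (λ t → (0 , t) ∈ topRimRow (suc x) c) (m∸[m∸n]≡n j≤x) (∈-map⁺ _ (∈-upTo⁺ x∸j<c))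
  where
  x∸j<c : x ∸ j < c
  x∸j<c = +-cancelˡ-< j (x ∸ j) c (begin-strict
    j + (x ∸ j) ≡⟨ m+[n∸m]≡n j≤x ⟩
    x           <⟨ n<1+n x ⟩
    suc x       ≡⟨ m∸n+n≡m c≤x ⟨
    suc x ∸ c + c ≤⟨ +-monoˡ-≤ c x∸c≤j ⟩
    j + c       ∎)
    where open ≤-Reasoning

∉-map-down : ∀ {S j} → ¬ ((0 , j) ∈ map down S)
∉-map-down m with ∈-map⁻ down m
... | _ , _ , ()

∈-map-down⁻ : ∀ {S i j} → (suc i , j) ∈ map down S → (i , j) ∈ S
∈-map-down⁻ m with ∈-map⁻ down m
... | _ , m′ , refl = m′

<∸⇔∉topRimRow : ∀ {x c} j → c ≤ x → (j < x ∸ c) ⇔ (j < x × ¬ ((0 , j) ∈ topRimRow x c))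
<∸⇔∉topRimRow {x} {c} j c≤x = mk⇔ to from
  where
  to : j < x ∸ c → j < x × ¬ ((0 , j) ∈ topRimRow x c)
  to j<x∸c = ≤-trans j<x∸c (m∸n≤m x c) , λ m → <⇒≱ j<x∸c (∈-topRimRow⁻ c≤x m)
  from : j < x × ¬ ((0 , j) ∈ topRimRow x c) → j < x ∸ c
  from (j<x , ∉) with j <? x ∸ c
  ... | yes j<x∸c = j<x∸c
  ... | no  j≮x∸c = ⊥-elim (∉ (∈-topRimRow⁺ c≤x (≮⇒≥ j≮x∸c) j<x))

DiagramMinus : Partition → List Node → Partition → Set
DiagramMinus λ′ S μ = ∀ n → InDiag μ n ⇔ (InDiag λ′ n × ¬ (n ∈ S))

diagramMinus-[] : ∀ λ′ → DiagramMinus λ′ [] λ′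
diagramMinus-[] λ′ n = mk⇔ (λ d → d , λ ()) proj₁

diagramMinus-∷ : ∀ {x c λ′ μ μ′ S} → c ≤ x →
  (∀ j → InDiag μ (0 , j) ⇔ (j < x ∸ c)) →
  (∀ i j → InDiag μ (suc i , j) ⇔ InDiag μ′ (i , j)) →
  DiagramMinus λ′ S μ′ → DiagramMinus (x ∷ λ′) (topRimRow x c ++ map down S) μ
diagramMinus-∷ {x} {c} {λ′} {μ} {μ′} {S} c≤x top below rest (zero , j) = mk⇔ to from
  where
  top⇔ = <∸⇔∉topRimRow j c≤x
  to : InDiag μ (0 , j) → j < x × ¬ ((0 , j) ∈ topRimRow x c ++ map down S)
  to d with Equivalence.to top⇔ (Equivalence.to (top j) d)
  ... | j<x , ∉ = j<x , [ ∉ , ∉-map-down ]′ ∘ ∈-++⁻ (topRimRow x c)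
  from : j < x × ¬ ((0 , j) ∈ topRimRow x c ++ map down S) → InDiag μ (0 , j)
  from (j<x , ∉) = Equivalence.from (top j) (Equivalence.from top⇔ (j<x , ∉ ∘ ∈-++⁺ˡ))
diagramMinus-∷ {x} {c} {λ′} {μ} {μ′} {S} c≤x top below rest (suc i , j) = mk⇔ to from
  where
  to : InDiag μ (suc i , j) → InDiag λ′ (i , j) × ¬ ((suc i , j) ∈ topRimRow x c ++ map down S)
  to d with Equivalence.to (rest (i , j)) (Equivalence.to (below i j) d)
  ... | d′ , ∉ = d′ , [ 1+n≢0 ∘ topRimRow-row {x} {c} , ∉ ∘ ∈-map-down⁻ ]′ ∘ ∈-++⁻ (topRimRow x c)
  from : InDiag λ′ (i , j) × ¬ ((suc i , j) ∈ topRimRow x c ++ map down S) → InDiag μ (suc i , j)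
  from (d′ , ∉) = Equivalence.from (below i j)
    (Equivalence.from (rest (i , j)) (d′ , ∉ ∘ ∈-++⁺ʳ (topRimRow x c) ∘ ∈-map⁺ down))

inDiag-shape-true-top : ∀ w j → InDiag (shape (true ∷ w)) (0 , j) ⇔ (j < zeros w)
inDiag-shape-true-top w j with zeros w
... | zero  = mk⇔ (λ ()) (λ ())
... | suc _ = mk⇔ (λ d → d) (λ d → d)

inDiag-shape-true-below : ∀ w i j → InDiag (shape (true ∷ w)) (suc i , j) ⇔ InDiag (shape w) (i , j)
inDiag-shape-true-below w i j with zeros w | zeros≡0⇒shape≡[] w
... | zero  | e rewrite e refl = mk⇔ (λ ()) (λ ())
... | suc _ | _ = mk⇔ (λ d → d) (λ d → d)

take-topRimRow : ∀ x {n c} (ys : List Node) → n ≤ c → take n (topRimRow x c ++ ys) ≡ topRimRow x n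
take-topRimRow x {n} {c} ys n≤c = begin
  take n (topRimRow x c ++ ys) ≡⟨ take-++-≤ n (topRimRow x c) ys (subst (n ≤_) (sym (length-topRimRow x c)) n≤c) ⟩
  take n (topRimRow x c)       ≡⟨ take-map n (upTo c) ⟩
  map _ (take n (upTo c))       ≡⟨ cong (map _) (take-applyUpTo (λ k → k) n≤c) ⟩
  topRimRow x n                 ∎
  where open ≡-Reasoning

RemovesRimPrefix : ℕ → Partition → Partition → Set
RemovesRimPrefix n λ′ μ = length (take n (rim λ′)) ≡ n × DiagramMinus λ′ (take n (rim λ′)) μ

removesRimPrefix-top : ∀ {x c λ′ μ} → c ≤ x ∸ (part λ′ 0 ∸ 1) → c ≤ x →
  (∀ j → InDiag μ (0 , j) ⇔ (j < x ∸ c)) →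
  (∀ i j → InDiag μ (suc i , j) ⇔ InDiag λ′ (i , j)) →
  RemovesRimPrefix c (x ∷ λ′) μ
removesRimPrefix-top {x} {c} {λ′} {μ} c≤c₀ c≤x top below
  rewrite rim-∷ x λ′ | take-topRimRow x (map down (rim λ′)) c≤c₀
  = length-topRimRow x c
  , subst (λ S → DiagramMinus (x ∷ λ′) S μ) (++-identityʳ (topRimRow x c))
      (diagramMinus-∷ {μ = μ} {μ′ = λ′} c≤x top below (diagramMinus-[] λ′))

removesRimPrefix-∷ : ∀ {x c n λ′ μ μ′} → x ∸ (part λ′ 0 ∸ 1) ≡ c →
  (∀ j → InDiag μ (0 , j) ⇔ (j < x ∸ c)) →
  (∀ i j → InDiag μ (suc i , j) ⇔ InDiag μ′ (i , j)) →
  RemovesRimPrefix n λ′ μ′ → RemovesRimPrefix (c + n) (x ∷ λ′) μ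
removesRimPrefix-∷ {x} {c} {n} {λ′} {μ} {μ′} refl top below (len , minus)
  rewrite rim-∷ x λ′
        | take-++-length n (topRimRow x c) (map down (rim λ′)) (length-topRimRow x c)
        | take-map {f = down} n (rim λ′)
  = trans (length-++ (topRimRow x c)) (cong₂ _+_ (length-topRimRow x c) (trans (length-map down (take n (rim λ′))) len))
  , diagramMinus-∷ {μ = μ} {μ′ = μ′} (m∸n≤m x (part λ′ 0 ∸ 1)) top below minus

topHook : ∀ m B C → RemovesRimPrefix (suc (m + length B))
  (shape (true ∷ replicate m false ++ B ++ false ∷ C)) (shape (replicate m false ++ B ++ true ∷ C))
topHook m [] C
  rewrite shape-true (replicate m false ++ false ∷ C) (trans (zeros-falses-++ m (false ∷ C)) (+-suc m (zeros C)))
        | shape-falses-++ m (false ∷ C) | shape-falses-++ m (true ∷ C) | +-identityʳ m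
  = removesRimPrefix-top {μ = shape (true ∷ C)} c≤c₀ (s≤s (m≤m+n m (zeros C))) top (inDiag-shape-true-below C)
  where
  c≤c₀ : suc m ≤ suc (m + zeros C) ∸ (part (shape C) 0 ∸ 1)
  c≤c₀ = begin
    suc m                                   ≡⟨ m+n∸n≡m (suc m) (zeros C) ⟨
    suc (m + zeros C) ∸ zeros C
      ≤⟨ ∸-monoʳ-≤ (suc (m + zeros C)) (≤-trans (m∸n≤m _ 1) (head-shape≤zeros C)) ⟩
    suc (m + zeros C) ∸ (part (shape C) 0 ∸ 1) ∎
    where open ≤-Reasoning
  top : ∀ j → InDiag (shape (true ∷ C)) (0 , j) ⇔ (j < suc (m + zeros C) ∸ suc m)
  top j rewrite m+n∸m≡n m (zeros C) = inDiag-shape-true-top C j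
topHook m (false ∷ B) C
  rewrite falses-∷ m (B ++ false ∷ C) | falses-∷ m (B ++ true ∷ C) | +-suc m (length B)
  = topHook (suc m) B C
topHook m (true ∷ B) C
  rewrite shape-true (replicate m false ++ true ∷ B ++ false ∷ C) {m + (zeros B + zeros C)}
            (trans (zeros-falses-++ m (true ∷ B ++ false ∷ C)) (trans (cong (m +_) (zeros-++-false B C)) (+-suc m _)))
        | shape-falses-++ m (true ∷ B ++ false ∷ C) | shape-falses-++ m (true ∷ B ++ true ∷ C)
  = removesRimPrefix-∷ {μ = shape (true ∷ B ++ true ∷ C)} {μ′ = shape (B ++ true ∷ C)}
      c≡ top (inDiag-shape-true-below (B ++ true ∷ C)) (topHook 0 B C)
  where
  z = zeros B + zeros C
  c≡ : suc (m + z) ∸ (part (shape (true ∷ B ++ false ∷ C)) 0 ∸ 1) ≡ suc m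
  c≡ rewrite shape-true (B ++ false ∷ C) (zeros-++-false B C) = m+n∸n≡m (suc m) z
  top : ∀ j → InDiag (shape (true ∷ B ++ true ∷ C)) (0 , j) ⇔ (j < suc (m + z) ∸ suc m)
  top j rewrite m+n∸m≡n m z | sym (zeros-++ B (true ∷ C)) = inDiag-shape-true-top (B ++ true ∷ C) j

data Swap (p : ℕ) : List Bool → List Bool → Set where
  swap : ∀ A B C → suc (length B) ≡ p → Swap p (A ++ true ∷ B ++ false ∷ C) (A ++ false ∷ B ++ true ∷ C)

removesRimHook-∷ : ∀ {p x λ′ μ} → RemovesRimHook p λ′ μ → IsPartition (x ∷ μ) →
  RemovesRimHook p (x ∷ λ′) (x ∷ μ)
removesRimHook-∷ {p} {x} {λ′} {μ} (_ , k , len , minus) xμ = xμ , c + k , len′ , minus′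
  where
  c = x ∸ (part λ′ 0 ∸ 1)
  S = take p (drop k (rim λ′))
  hook≡ : take p (drop (c + k) (rim (x ∷ λ′))) ≡ map down S
  hook≡ = begin
    take p (drop (c + k) (rim (x ∷ λ′)))                          ≡⟨ cong (take p ∘ drop (c + k)) (rim-∷ x λ′) ⟩
    take p (drop (c + k) (topRimRow x c ++ map down (rim λ′)))
      ≡⟨ cong (take p) (drop-++-length k (topRimRow x c) _ (length-topRimRow x c)) ⟩
    take p (drop k (map down (rim λ′)))                           ≡⟨ cong (take p) (drop-map k (rim λ′)) ⟩
    take p (map down (drop k (rim λ′)))                           ≡⟨ take-map p (drop k (rim λ′)) ⟩
    map down S                                                    ∎
    where open ≡-Reasoning
  len′ : length (take p (drop (c + k) (rim (x ∷ λ′)))) ≡ p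
  len′ = trans (cong length hook≡) (trans (length-map down S) len)
  minus′ : DiagramMinus (x ∷ λ′) (take p (drop (c + k) (rim (x ∷ λ′)))) (x ∷ μ)
  minus′ = subst (λ S′ → DiagramMinus (x ∷ λ′) S′ (x ∷ μ)) (sym hook≡)
    (diagramMinus-∷ {μ = x ∷ μ} {μ′ = μ} z≤n (λ _ → mk⇔ (λ d → d) (λ d → d)) (λ _ _ → mk⇔ (λ d → d) (λ d → d)) minus)

hook : ∀ A B C → RemovesRimHook (suc (length B))
  (shape (A ++ true ∷ B ++ false ∷ C)) (shape (A ++ false ∷ B ++ true ∷ C))
hook []          B C = shape-isPartition (false ∷ B ++ true ∷ C) , 0 , topHook 0 B C
hook (false ∷ A) B C = hook A B C
hook (true ∷ A)  B C
  rewrite shape-true (A ++ true ∷ B ++ false ∷ C) (zeros-true-false A B C)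
        | shape-true (A ++ false ∷ B ++ true ∷ C) (zeros-false-true A B C)
  = removesRimHook-∷ (hook A B C)
      (subst IsPartition (shape-true (A ++ false ∷ B ++ true ∷ C) (zeros-false-true A B C))
        (shape-isPartition (true ∷ A ++ false ∷ B ++ true ∷ C)))

swap⇒removesRimHook : ∀ {p u v} → Swap p u v → RemovesRimHook p (shape u) (shape v)
swap⇒removesRimHook (swap A B C refl) = hook A B C

shape-rect : ∀ a b m → 1 ≤ b → shape (replicate a true ++ replicate b false ++ replicate m true) ≡ rect b a
shape-rect zero    b m _ = trans (shape-falses-++ b (replicate m true)) (shape-trues m)
shape-rect (suc a) (suc b) m _ =
  trans (shape-true (replicate a true ++ replicate (suc b) false ++ replicate m true) zeros≡b)
        (cong (suc b ∷_) (shape-rect a (suc b) m (s≤s z≤n)))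
  where
  zeros≡b : zeros (replicate a true ++ replicate (suc b) false ++ replicate m true) ≡ suc b
  zeros≡b = trans (zeros-trues-++ a _) (trans (zeros-falses-++ (suc b) _)
    (trans (cong (suc b +_) (zeros-trues m)) (+-identityʳ _)))

length-rimFrom-∷ : ∀ i x μ → length (rimFrom i (x ∷ μ)) ≡ (x ∸ (part μ 0 ∸ 1)) + length (rimFrom (suc i) μ)
length-rimFrom-∷ i x μ = trans (length-++ (map (λ k → (i , x ∸ 1 ∸ k)) (upTo c)))
  (cong (_+ length (rimFrom (suc i) μ)) (trans (length-map (λ k → (i , x ∸ 1 ∸ k)) (upTo c)) (length-applyUpTo (λ k → k) c)))
  where c = x ∸ (part μ 0 ∸ 1)

length-rim-rect : ∀ i A L → length (rimFrom i (rect (suc L) (suc A))) ≡ A + suc L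
length-rim-rect i zero    L = trans (length-rimFrom-∷ i (suc L) []) (+-identityʳ (suc L))
length-rim-rect i (suc A) L = trans (length-rimFrom-∷ i (suc L) (rect (suc L) (suc A)))
  (cong₂ _+_ (m+n∸n≡m 1 L) (length-rim-rect (suc i) A L))

length-rim-rect< : ∀ p L A → 1 ≤ L → L + A ≤ p → length (rim (rect L A)) < p
length-rim-rect< p L       zero    1≤L L+A≤p = ≤-trans 1≤L (≤-trans (m≤m+n L 0) L+A≤p)
length-rim-rect< p (suc L) (suc A) _   L+A≤p =
  subst (_≤ p) (trans (+-comm (suc L) (suc A)) (cong suc (sym (length-rim-rect 0 A L)))) L+A≤p

rect-noRimHook : ∀ p L A → 1 ≤ L → L + A ≤ p → ∀ ν → ¬ RemovesRimHook p (rect L A) ν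
rect-noRimHook p L A 1≤L L+A≤p ν (_ , k , len , _) =
  <⇒≱ (length-rim-rect< p L A 1≤L L+A≤p) (begin
    p                          ≡⟨ len ⟨
    length (take p (drop k R)) ≡⟨ length-take p (drop k R) ⟩
    p ⊓ length (drop k R)      ≤⟨ m⊓n≤n p _ ⟩
    length (drop k R)          ≡⟨ length-drop k R ⟩
    length R ∸ k               ≤⟨ m∸n≤m (length R) k ⟩
    length R                   ∎)
  where
  open ≤-Reasoning
  R = rim (rect L A)

⊓+⊔ : ∀ m n → m ⊓ n + (m ⊔ n) ≡ m + n
⊓+⊔ m n with ≤-total m n
... | inj₁ m≤n rewrite m≤n⇒m⊓n≡m m≤n | m≤n⇒m⊔n≡n m≤n = refl
... | inj₂ n≤m rewrite m≥n⇒m⊓n≡n n≤m | m≥n⇒m⊔n≡m n≤m = +-comm n m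

rect-⊔-⊓ : ∀ P {s e t u} → t ≤ u → (s ≡ t × e ≡ u) ⊎ (s ≡ u × e ≡ t) →
  rect (P ∸ (s ⊔ e)) (s ⊓ e) ≡ rect (P ∸ u) t
rect-⊔-⊓ P t≤u (inj₁ (refl , refl)) = cong₂ rect (cong (P ∸_) (m≤n⇒m⊔n≡n t≤u)) (m≤n⇒m⊓n≡m t≤u)
rect-⊔-⊓ P t≤u (inj₂ (refl , refl)) = cong₂ rect (cong (P ∸_) (m≥n⇒m⊔n≡m t≤u)) (m≥n⇒m⊓n≡n t≤u)

last-∷ʳ : ∀ {A : Set} (xs : List A) a → last (xs ∷ʳ a) ≡ just a
last-∷ʳ []           a = refl
last-∷ʳ (_ ∷ [])     a = refl
last-∷ʳ (_ ∷ y ∷ xs) a = last-∷ʳ (y ∷ xs) a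

-- R_p lists the columns in reverse order, so its last column is the one computed from λ itself.
residueSymbol-last : ∀ q λ′ {a b} → All (0 <_) λ′ → last (residueSymbol q λ′) ≡ just (a , b) →
  b ≡ ℤ.+ 1 ℤ.- ℤ.+ length λ′
residueSymbol-last q []          _         ()
residueSymbol-last q (zero ∷ μ)  (() ∷ _) _
residueSymbol-last q (suc x ∷ μ) _ last≡ = cong proj₂ (just-injective (trans (sym last≡)
  (trans (cong last (unfold-reverse (column first) (map column rest))) (last-∷ʳ (reverse (map column rest)) (column first)))))
  where
  column : ℕ × ℕ → ℤ × ℤ
  column (a , r) = (ℤ.+ a ℤ.- ℤ.+ r , ℤ.+ 1 ℤ.- ℤ.+ r)
  first = (length (pRim q (suc x ∷ μ)) , length (suc x ∷ μ))
  rest = rimDataAux q (x + sum μ) (removePRim q (suc x ∷ μ))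

%-cong-+ˡ : ∀ {m n} o d .⦃ _ : NonZero d ⦄ → m % d ≡ n % d → (o + m) % d ≡ (o + n) % d
%-cong-+ˡ {m} {n} o d m≡n = begin
  (o + m) % d           ≡⟨ %-distribˡ-+ o m d ⟩
  (o % d + m % d) % d   ≡⟨ cong (λ t → (o % d + t) % d) m≡n ⟩
  (o % d + n % d) % d   ≡⟨ %-distribˡ-+ o n d ⟨
  (o + n) % d           ∎
  where open ≡-Reasoning

%-cong-+ʳ : ∀ {m n} o d .⦃ _ : NonZero d ⦄ → m % d ≡ n % d → (m + o) % d ≡ (n + o) % d
%-cong-+ʳ {m} {n} o d m≡n =
  subst₂ (λ a b → a % d ≡ b % d) (+-comm o m) (+-comm o n) (%-cong-+ˡ o d m≡n)

-- Adding o * d is adding o and then o * (d - 1).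
%-cancel-+ˡ : ∀ {m n} o d .⦃ _ : NonZero d ⦄ → (o + m) % d ≡ (o + n) % d → m % d ≡ n % d
%-cancel-+ˡ {m} {n} o d@(suc d′) o+m≡o+n = begin
  m % d                   ≡⟨ [m+kn]%n≡m%n m o d ⟨
  (m + o * d) % d         ≡⟨ cong (_% d) (shift m) ⟩
  (o + m + o * d′) % d    ≡⟨ %-cong-+ʳ {o + m} {o + n} (o * d′) d o+m≡o+n ⟩
  (o + n + o * d′) % d    ≡⟨ cong (_% d) (shift n) ⟨
  (n + o * d) % d         ≡⟨ [m+kn]%n≡m%n n o d ⟩
  n % d                   ∎
  where
  open ≡-Reasoning
  shift : ∀ x → x + o * d ≡ o + x + o * d′
  shift x = trans (cong (x +_) (*-suc o d′)) (trans (sym (+-assoc x o _)) (cong (_+ o * d′) (+-comm x o)))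

%-cancel-+ʳ : ∀ {m n} o d .⦃ _ : NonZero d ⦄ → (m + o) % d ≡ (n + o) % d → m % d ≡ n % d
%-cancel-+ʳ {m} {n} o d m+o≡n+o =
  %-cancel-+ˡ o d (subst₂ (λ a b → a % d ≡ b % d) (+-comm m o) (+-comm n o) m+o≡n+o)

∣∸⇔%≡ : ∀ {m n} d .⦃ _ : NonZero d ⦄ → n ≤ m → d ∣ m ∸ n ⇔ m % d ≡ n % d
∣∸⇔%≡ {m} {n} d@(suc _) n≤m = mk⇔ to from
  where
  m≡n+[m∸n] : m ≡ n + (m ∸ n)
  m≡n+[m∸n] = sym (m+[n∸m]≡n n≤m)
  to : d ∣ m ∸ n → m % d ≡ n % d
  to d∣m∸n = trans (cong (_% d) m≡n+[m∸n]) (%-remove-+ʳ n d∣m∸n)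
  from : m % d ≡ n % d → d ∣ m ∸ n
  from m≡n = m%n≡0⇒n∣m (m ∸ n) d (%-cancel-+ˡ {n = 0} n d
    (trans (cong (_% d) (sym m≡n+[m∸n])) (trans m≡n (cong (_% d) (sym (+-identityʳ n))))))

∣∣⊖∣⇔%≡ : ∀ m n d .⦃ _ : NonZero d ⦄ → d ∣ abs (m ⊖ n) ⇔ m % d ≡ n % d
∣∣⊖∣⇔%≡ m n d with ≤-total n m
... | inj₁ n≤m =
  subst (λ k → d ∣ k ⇔ m % d ≡ n % d) (trans (sym (ℤP.∣⊖∣-≤ n≤m)) (ℤP.∣m⊖n∣≡∣n⊖m∣ n m)) (∣∸⇔%≡ d n≤m)
... | inj₂ m≤n = subst (λ k → d ∣ k ⇔ m % d ≡ n % d) (sym (ℤP.∣⊖∣-≤ m≤n))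
  (mk⇔ (sym ∘ Equivalence.to (∣∸⇔%≡ d m≤n)) (Equivalence.from (∣∸⇔%≡ d m≤n) ∘ sym))

mod⇔%≡ : ∀ {m n} d .⦃ _ : NonZero d ⦄ → ((ℤ.+ m) ≡ ℤ.+ n [mod d ]) ⇔ (m % d ≡ n % d)
mod⇔%≡ {m} {n} d = subst (λ z → d ∣ abs z ⇔ m % d ≡ n % d) (sym (ℤP.m-n≡m⊖n m n)) (∣∣⊖∣⇔%≡ m n d)

sub-mod⇔%≡ : ∀ {l a α} d .⦃ _ : NonZero d ⦄ → ((ℤ.+ l ℤ.- ℤ.+ a) ≡ ℤ.+ α [mod d ]) ⇔ (l % d ≡ (a + α) % d)
sub-mod⇔%≡ {l} {a} {α} d = subst (λ z → d ∣ abs z ⇔ l % d ≡ (a + α) % d) (sym regroup) (mod⇔%≡ d)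
  where
  sub-sub : ∀ x y z → x ℤ.- y ℤ.- z ≡ x ℤ.- (y ℤ.+ z)
  sub-sub = ℤ-Solver.solve-∀
  regroup : ℤ.+ l ℤ.- ℤ.+ a ℤ.- ℤ.+ α ≡ ℤ.+ l ℤ.- ℤ.+ (a + α)
  regroup = trans (sub-sub (ℤ.+ l) (ℤ.+ a) (ℤ.+ α)) (cong (λ z → ℤ.+ l ℤ.- z) (sym (ℤP.pos-+ a α)))

boolToℕ : Bool → ℕ
boolToℕ false = 0
boolToℕ true  = 1

bitAt : List Bool → ℕ → Bool
bitAt []      _       = false
bitAt (b ∷ _) zero    = b
bitAt (_ ∷ w) (suc i) = bitAt w i

bitAt-falses : ∀ o i → bitAt (replicate o false) i ≡ false
bitAt-falses zero    i       = refl
bitAt-falses (suc o) zero    = refl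
bitAt-falses (suc o) (suc i) = bitAt-falses o i

bitAt-falses-∷-here : ∀ o b w → bitAt (replicate o false ++ b ∷ w) o ≡ b
bitAt-falses-∷-here zero    b w = refl
bitAt-falses-∷-here (suc o) b w = bitAt-falses-∷-here o b w

bitAt-falses-++-last : ∀ o w → bitAt (replicate (suc o) false ++ w) o ≡ false
bitAt-falses-++-last zero    w = refl
bitAt-falses-++-last (suc o) w = bitAt-falses-++-last o w

bitAt-falses-∷-there : ∀ o b w {i} → i ≢ o →
  bitAt (replicate o false ++ b ∷ w) i ≡ bitAt (replicate (suc o) false ++ w) i
bitAt-falses-∷-there zero    b w {zero}  i≢o = ⊥-elim (i≢o refl)
bitAt-falses-∷-there zero    b w {suc i} i≢o = refl
bitAt-falses-∷-there (suc o) b w {zero}  i≢o = refl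
bitAt-falses-∷-there (suc o) b w {suc i} i≢o = bitAt-falses-∷-there o b w (i≢o ∘ cong suc)

bitAt-trues : ∀ {a i} → i < a → bitAt (replicate a true) i ≡ true
bitAt-trues {suc a} {zero}  _       = refl
bitAt-trues {suc a} {suc i} (s≤s h) = bitAt-trues h

bitAt-applyUpTo : ∀ (f : ℕ → Bool) {n i} → i < n → bitAt (applyUpTo f n) i ≡ f i
bitAt-applyUpTo f {suc n} {zero}  _       = refl
bitAt-applyUpTo f {suc n} {suc i} (s≤s h) = bitAt-applyUpTo (f ∘ suc) h

applyUpTo-bitAt : ∀ w → applyUpTo (bitAt w) (length w) ≡ w
applyUpTo-bitAt []      = refl
applyUpTo-bitAt (b ∷ w) = cong (b ∷_) (applyUpTo-bitAt w)

applyUpTo-cong : ∀ {A : Set} n {f g : ℕ → A} → (∀ i → i < n → f i ≡ g i) → applyUpTo f n ≡ applyUpTo g n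
applyUpTo-cong zero    f≗g = refl
applyUpTo-cong (suc n) f≗g = cong₂ _∷_ (f≗g 0 (s≤s z≤n)) (applyUpTo-cong n (λ i i<n → f≗g (suc i) (s≤s i<n)))

applyUpTo-const : ∀ {A : Set} (x : A) n → applyUpTo (λ _ → x) n ≡ replicate n x
applyUpTo-const x zero    = refl
applyUpTo-const x (suc n) = cong (x ∷_) (applyUpTo-const x n)

zipWith-applyUpTo : ∀ (_⊕_ : Bool → Bool → Bool) n (f g : ℕ → Bool) →
  zipWith _⊕_ (applyUpTo f n) (applyUpTo g n) ≡ applyUpTo (λ i → f i ⊕ g i) n
zipWith-applyUpTo _⊕_ zero    f g = refl
zipWith-applyUpTo _⊕_ (suc n) f g = cong (f 0 ⊕ g 0 ∷_) (zipWith-applyUpTo _⊕_ n (f ∘ suc) (g ∘ suc))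

replicate-+ : ∀ {A : Set} (x : A) a b → replicate (a + b) x ≡ replicate a x ++ replicate b x
replicate-+ x zero    b = refl
replicate-+ x (suc a) b = cong (x ∷_) (replicate-+ x a b)

≤ᵇ-true : ∀ {m n} → m ≤ n → (m ≤ᵇ n) ≡ true
≤ᵇ-true m≤n = Equivalence.to T-≡ (≤⇒≤ᵇ m≤n)

≤ᵇ-false : ∀ {m n} → n < m → (m ≤ᵇ n) ≡ false
≤ᵇ-false {m} {n} n<m with m ≤ᵇ n in eq
... | false = refl
... | true  = ⊥-elim (<⇒≱ n<m (≤ᵇ⇒≤ m n (subst T (sym eq) _)))

≤ᵇ-⊓ : ∀ k M a → suc k ≤ M → (suc k ≤ᵇ a) ≡ (suc k ≤ᵇ a ⊓ M)
≤ᵇ-⊓ k M a k<M with a ≤? M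
... | yes a≤M = cong (suc k ≤ᵇ_) (sym (m≤n⇒m⊓n≡m a≤M))
... | no  a≰M =
  trans (≤ᵇ-true (≤-trans k<M M≤a)) (trans (sym (≤ᵇ-true k<M)) (cong (suc k ≤ᵇ_) (sym (m≥n⇒m⊓n≡n M≤a))))
  where
  M≤a : M ≤ a
  M≤a = <⇒≤ (≰⇒> a≰M)

∧-≤ᵇ : ∀ M a b → a ≤ suc M → (b ∧ (suc M ≤ᵇ a)) ≡ (suc (suc M) ≤ᵇ boolToℕ b + a)
∧-≤ᵇ M a true  a≤M = refl
∧-≤ᵇ M a false a≤M = sym (≤ᵇ-false (s≤s a≤M))

∨-≤ᵇ : ∀ M a b {k} → a ≤ suc M → k < suc M →
  (suc k ≤ᵇ boolToℕ (b ∨ (suc M ≤ᵇ a)) + a ⊓ M) ≡ (suc k ≤ᵇ boolToℕ b + a)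
∨-≤ᵇ M a b a≤M k≤M with m≤n⇒m<n∨m≡n a≤M
∨-≤ᵇ M a b     _ _ | inj₁ (s≤s a≤M) rewrite ≤ᵇ-false {suc M} (s≤s a≤M) | m≤n⇒m⊓n≡m a≤M with b
... | true  = refl
... | false = refl
∨-≤ᵇ M _ true  _ (s≤s k≤M) | inj₂ refl rewrite m≥n⇒m⊓n≡n (n≤1+n M) =
  trans (≤ᵇ-true (s≤s k≤M)) (sym (≤ᵇ-true (s≤s (m≤n⇒m≤1+n k≤M))))
∨-≤ᵇ M _ false _ _         | inj₂ refl rewrite ≤ᵇ-true (≤-refl {suc M}) | m≥n⇒m⊓n≡n (n≤1+n M) = refl

-- The p-abacus

module _ (p : ℕ) ⦃ _ : NonZero p ⦄ where

  -- The number of `true`s of w on runner ρ, when w starts at position o.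
  beads : ℕ → List Bool → ℕ → ℕ
  beads o []          ρ = 0
  beads o (true ∷ w)  ρ = boolToℕ (does (o % p ≟ ρ)) + beads (suc o) w ρ
  beads o (false ∷ w) ρ = beads (suc o) w ρ

  beads-++ : ∀ o u w ρ → beads o (u ++ w) ρ ≡ beads o u ρ + beads (o + length u) w ρ
  beads-++ o []          w ρ = cong (λ t → beads t w ρ) (sym (+-identityʳ o))
  beads-++ o (true ∷ u)  w ρ = trans (cong (_ +_) (trans (beads-++ (suc o) u w ρ)
    (cong (λ t → beads (suc o) u ρ + beads t w ρ) (sym (+-suc o (length u))))))
    (sym (+-assoc (boolToℕ (does (o % p ≟ ρ))) (beads (suc o) u ρ) _))
  beads-++ o (false ∷ u) w ρ = trans (beads-++ (suc o) u w ρ)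
    (cong (λ t → beads (suc o) u ρ + beads t w ρ) (sym (+-suc o (length u))))

  beads-cong : ∀ {o o′} → o % p ≡ o′ % p → ∀ w ρ → beads o w ρ ≡ beads o′ w ρ
  beads-cong o≡o′ []          ρ = refl
  beads-cong o≡o′ (true ∷ w)  ρ =
    cong₂ _+_ (cong (λ t → boolToℕ (does (t ≟ ρ))) o≡o′) (beads-cong (%-cong-+ˡ 1 p o≡o′) w ρ)
  beads-cong o≡o′ (false ∷ w) ρ = beads-cong (%-cong-+ˡ 1 p o≡o′) w ρ

  beads-+p : ∀ o w ρ → beads (o + p) w ρ ≡ beads o w ρ
  beads-+p o = beads-cong ([m+n]%n≡m%n o p)

  beads-falses : ∀ o g ρ → beads o (replicate g false) ρ ≡ 0
  beads-falses o zero    ρ = refl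
  beads-falses o (suc g) ρ = beads-falses (suc o) g ρ

  beads-falses-++ : ∀ o g w ρ → beads o (replicate g false ++ w) ρ ≡ beads (o + g) w ρ
  beads-falses-++ o g w ρ = trans (beads-++ o (replicate g false) w ρ)
    (cong₂ _+_ (beads-falses o g ρ) (cong (λ t → beads (o + t) w ρ) (length-replicate g)))

  beads-trues-++ : ∀ o a w ρ → beads o (replicate a true ++ w) ρ ≡ beads o (replicate a true) ρ + beads (o + a) w ρ
  beads-trues-++ o a w ρ = trans (beads-++ o (replicate a true) w ρ)
    (cong (λ t → beads o (replicate a true) ρ + beads (o + t) w ρ) (length-replicate a))

  beads-trues-+ : ∀ o a b ρ →
    beads o (replicate (a + b) true) ρ ≡ beads o (replicate a true) ρ + beads (o + a) (replicate b true) ρ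
  beads-trues-+ o a b ρ = trans (cong (λ w → beads o w ρ) (replicate-+ true a b)) (beads-trues-++ o a _ ρ)

  -- Within the first p positions every runner holds at most one letter.
  beads-short : ∀ o c ρ → o + length c ≤ p → ρ < p → beads o c ρ ≡ boolToℕ (bitAt (replicate o false ++ c) ρ)
  beads-short o []      ρ _ _ =
    cong boolToℕ (sym (trans (cong (λ w → bitAt w ρ) (++-identityʳ (replicate o false))) (bitAt-falses o ρ)))
  beads-short o (b ∷ c) ρ o+c≤p ρ<p = go b (ρ ≟ o)
    where
    o+c<p : suc o + length c ≤ p
    o+c<p = subst (_≤ p) (+-suc o (length c)) o+c≤p
    o<p : o < p
    o<p = ≤-trans (s≤s (m≤m+n o (length c))) o+c<p
    IH : beads (suc o) c ρ ≡ boolToℕ (bitAt (replicate (suc o) false ++ c) ρ)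
    IH = beads-short (suc o) c ρ o+c<p ρ<p
    go : ∀ b → Dec (ρ ≡ o) → beads o (b ∷ c) ρ ≡ boolToℕ (bitAt (replicate o false ++ b ∷ c) ρ)
    go true (yes refl) rewrite m<n⇒m%n≡m o<p | dec-true (ρ ≟ ρ) refl | IH
      | bitAt-falses-++-last ρ c | bitAt-falses-∷-here ρ true c = refl
    go false (yes refl) rewrite IH | bitAt-falses-++-last ρ c | bitAt-falses-∷-here ρ false c = refl
    go true (no ρ≢o) rewrite m<n⇒m%n≡m o<p | dec-false (o ≟ ρ) (ρ≢o ∘ sym) | IH
      | bitAt-falses-∷-there o true c ρ≢o = refl
    go false (no ρ≢o) rewrite IH | bitAt-falses-∷-there o false c ρ≢o = refl

  beads-row : ∀ c ρ → length c ≡ p → ρ < p → beads 0 c ρ ≡ boolToℕ (bitAt c ρ)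
  beads-row c ρ c≡p = beads-short 0 c ρ (≤-reflexive c≡p)

  beads-period : ∀ o ρ → ρ < p → beads o (replicate p true) ρ ≡ 1
  beads-period zero    ρ ρ<p =
    trans (beads-row (replicate p true) ρ (length-replicate p) ρ<p) (cong boolToℕ (bitAt-trues ρ<p))
  beads-period (suc o) ρ ρ<p = trans (+-cancelˡ-≡ (trues o 1) _ _ shift) (beads-period o ρ ρ<p)
    where
    open ≡-Reasoning
    trues : ℕ → ℕ → ℕ
    trues o a = beads o (replicate a true) ρ
    shift : trues o 1 + trues (suc o) p ≡ trues o 1 + trues o p
    shift = begin
      trues o 1 + trues (suc o) p   ≡⟨ cong (λ t → trues o 1 + trues t p) (+-comm 1 o) ⟩
      trues o 1 + trues (o + 1) p   ≡⟨ beads-trues-+ o 1 p ρ ⟨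
      trues o (1 + p)               ≡⟨ cong (trues o) (+-comm 1 p) ⟩
      trues o (p + 1)               ≡⟨ beads-trues-+ o p 1 ρ ⟩
      trues o p + trues (o + p) 1   ≡⟨ cong (trues o p +_) (beads-+p o (replicate 1 true) ρ) ⟩
      trues o p + trues o 1         ≡⟨ +-comm (trues o p) _ ⟩
      trues o 1 + trues o p         ∎

  beads-periods : ∀ q o ρ → ρ < p → beads o (replicate (q * p) true) ρ ≡ q
  beads-periods zero    o ρ _   = refl
  beads-periods (suc q) o ρ ρ<p =
    trans (beads-trues-+ o p (q * p) ρ) (cong₂ _+_ (beads-period o ρ ρ<p) (beads-periods q (o + p) ρ ρ<p))

  -- Sorting by swaps

  row : (ℕ → Bool) → List Bool
  row f = applyUpTo f p

  -- M rows in which runner ρ carries n ρ beads, all pushed to the end.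
  sorted : (ℕ → ℕ) → ℕ → List Bool
  sorted n zero    = []
  sorted n (suc M) = row (λ ρ → suc M ≤ᵇ n ρ) ++ sorted n M

  row-bitAt : ∀ c → length c ≡ p → c ≡ row (bitAt c)
  row-bitAt c c≡p = trans (sym (applyUpTo-bitAt c)) (cong (applyUpTo (bitAt c)) c≡p)

  sorted-cong : ∀ M {n n′} → (∀ ρ → ρ < p → ∀ k → k < M → (suc k ≤ᵇ n ρ) ≡ (suc k ≤ᵇ n′ ρ)) →
    sorted n M ≡ sorted n′ M
  sorted-cong zero    _   = refl
  sorted-cong (suc M) n≈n′ = cong₂ _++_ (applyUpTo-cong p (λ ρ ρ<p → n≈n′ ρ ρ<p M ≤-refl))
    (sorted-cong M (λ ρ ρ<p k k<M → n≈n′ ρ ρ<p k (m<n⇒m<1+n k<M)))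

  sorted-cong-≡ : ∀ M {n n′} → (∀ ρ → ρ < p → n ρ ≡ n′ ρ) → sorted n M ≡ sorted n′ M
  sorted-cong-≡ M n≡n′ = sorted-cong M (λ ρ ρ<p k _ → cong (suc k ≤ᵇ_) (n≡n′ ρ ρ<p))

  zipWith-row : ∀ (_⊕_ : Bool → Bool → Bool) c f → length c ≡ p →
    zipWith _⊕_ c (row f) ≡ row (λ ρ → bitAt c ρ ⊕ f ρ)
  zipWith-row _⊕_ c f c≡p =
    trans (cong (λ t → zipWith _⊕_ t (row f)) (row-bitAt c c≡p)) (zipWith-applyUpTo _⊕_ p (bitAt c) f)

  beads-row-++ : ∀ c w ρ → length c ≡ p → ρ < p → beads 0 (c ++ w) ρ ≡ boolToℕ (bitAt c ρ) + beads 0 w ρ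
  beads-row-++ c w ρ c≡p ρ<p = begin
    beads 0 (c ++ w) ρ                 ≡⟨ beads-++ 0 c w ρ ⟩
    beads 0 c ρ + beads (length c) w ρ ≡⟨ cong (λ t → beads 0 c ρ + beads t w ρ) c≡p ⟩
    beads 0 c ρ + beads p w ρ          ≡⟨ cong₂ _+_ (beads-row c ρ c≡p ρ<p) (beads-+p 0 w ρ) ⟩
    boolToℕ (bitAt c ρ) + beads 0 w ρ  ∎
    where open ≡-Reasoning

  swap-++ˡ : ∀ c {u v} → Swap p u v → Swap p (c ++ u) (c ++ v)
  swap-++ˡ c (swap A B C B<p) = subst₂ (Swap p) (++-assoc c A _) (++-assoc c A _) (swap (c ++ A) B C B<p)

  swaps-++ˡ : ∀ c {u v} → Star (Swap p) u v → Star (Swap p) (c ++ u) (c ++ v)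
  swaps-++ˡ c = gmap (c ++_) (swap-++ˡ c)

  -- Compare-exchange of two rows p apart: a `true` above a `false` on the same runner drops.
  swapRows : ∀ X c m d post → length c ≡ length d → length c + length m ≡ p →
    Star (Swap p) (X ++ c ++ m ++ d ++ post) (X ++ zipWith _∧_ c d ++ m ++ zipWith _∨_ c d ++ post)
  swapRows X []      m []       post _   _     = ε
  swapRows X (b ∷ c) m (b′ ∷ d) post c≡d c+m≡p = begin
    X ++ (b ∷ c) ++ m ++ (b′ ∷ d) ++ post
      ⟶*⟨ swapHeads b b′ ⟩
    X ++ ((b ∧ b′) ∷ c) ++ m ++ ((b ∨ b′) ∷ d) ++ post
      ≡⟨ regroup (b ∧ b′) c (b ∨ b′) d ⟩
    (X ++ (b ∧ b′) ∷ []) ++ c ++ (m ++ (b ∨ b′) ∷ []) ++ d ++ post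
      ⟶*⟨ swapRows (X ++ (b ∧ b′) ∷ []) c (m ++ (b ∨ b′) ∷ []) d post (suc-injective c≡d) c+m′≡p ⟩
    (X ++ (b ∧ b′) ∷ []) ++ zipWith _∧_ c d ++ (m ++ (b ∨ b′) ∷ []) ++ zipWith _∨_ c d ++ post
      ≡⟨ regroup (b ∧ b′) (zipWith _∧_ c d) (b ∨ b′) (zipWith _∨_ c d) ⟨
    X ++ zipWith _∧_ (b ∷ c) (b′ ∷ d) ++ m ++ zipWith _∨_ (b ∷ c) (b′ ∷ d) ++ post ∎
    where
    open StarReasoning (Swap p)
    regroup : ∀ x c y d → X ++ (x ∷ c) ++ m ++ (y ∷ d) ++ post ≡ (X ++ x ∷ []) ++ c ++ (m ++ y ∷ []) ++ d ++ post
    regroup x c y d = sym (trans (++-assoc X (x ∷ []) _) (cong (λ t → X ++ x ∷ c ++ t) (++-assoc m (y ∷ []) (d ++ post))))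
    c+m′≡p : length c + length (m ++ (b ∨ b′) ∷ []) ≡ p
    c+m′≡p = trans (cong (length c +_) (trans (length-++ m) (+-comm (length m) 1)))
      (trans (+-suc (length c) (length m)) c+m≡p)
    swapHeads : ∀ b b′ → Star (Swap p) (X ++ (b ∷ c) ++ m ++ (b′ ∷ d) ++ post)
                                       (X ++ ((b ∧ b′) ∷ c) ++ m ++ ((b ∨ b′) ∷ d) ++ post)
    swapHeads true  false =
      subst₂ (Swap p) (cong (λ t → X ++ true ∷ t) (++-assoc c m _)) (cong (λ t → X ++ false ∷ t) (++-assoc c m _))
      (swap X (c ++ m) (d ++ post) (trans (cong suc (length-++ c)) c+m≡p)) ◅ ε
    swapHeads true  true  = ε
    swapHeads false b′    = ε

  insertRow : ∀ M n c → length c ≡ p → (∀ ρ → ρ < p → n ρ ≤ M) →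
    Star (Swap p) (c ++ sorted n M) (sorted (λ ρ → boolToℕ (bitAt c ρ) + n ρ) (suc M))
  insertRow zero n c c≡p n≤0 = begin
    c ++ []                                                ≡⟨ cong (_++ []) (row-bitAt c c≡p) ⟩
    row (bitAt c) ++ []                                    ≡⟨ cong (_++ []) (applyUpTo-cong p bit≡) ⟩
    row (λ ρ → 1 ≤ᵇ boolToℕ (bitAt c ρ) + n ρ) ++ []       ∎
    where
    open StarReasoning (Swap p)
    1≤ᵇ : ∀ b → b ≡ (1 ≤ᵇ boolToℕ b + 0)
    1≤ᵇ true  = refl
    1≤ᵇ false = refl
    bit≡ : ∀ ρ → ρ < p → bitAt c ρ ≡ (1 ≤ᵇ boolToℕ (bitAt c ρ) + n ρ)
    bit≡ ρ ρ<p rewrite n≤0⇒n≡0 (n≤0 ρ ρ<p) = 1≤ᵇ (bitAt c ρ)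
  insertRow (suc M) n c c≡p n≤M = begin
    c ++ d ++ sorted n M
      ⟶*⟨ swapRows [] c [] d (sorted n M) (trans c≡p (sym (length-applyUpTo _ p))) (trans (+-identityʳ _) c≡p) ⟩
    zipWith _∧_ c d ++ c′ ++ sorted n M
      ≡⟨ cong (λ t → zipWith _∧_ c d ++ c′ ++ t) (sorted-cong M (λ ρ _ k k<M → ≤ᵇ-⊓ k M (n ρ) k<M)) ⟩
    zipWith _∧_ c d ++ c′ ++ sorted n′ M
      ⟶*⟨ swaps-++ˡ (zipWith _∧_ c d) (insertRow M n′ c′ c′≡p (λ ρ _ → m⊓n≤n (n ρ) M)) ⟩
    zipWith _∧_ c d ++ sorted (λ ρ → boolToℕ (bitAt c′ ρ) + n′ ρ) (suc M)
      ≡⟨ cong₂ _++_ top rest ⟩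
    sorted (λ ρ → boolToℕ (bitAt c ρ) + n ρ) (suc (suc M)) ∎
    where
    open StarReasoning (Swap p)
    d = row (λ ρ → suc M ≤ᵇ n ρ)
    c′ = zipWith _∨_ c d
    n′ : ℕ → ℕ
    n′ ρ = n ρ ⊓ M
    c′≡p : length c′ ≡ p
    c′≡p = trans (cong length (zipWith-row _∨_ c _ c≡p)) (length-applyUpTo _ p)
    top : zipWith _∧_ c d ≡ row (λ ρ → suc (suc M) ≤ᵇ boolToℕ (bitAt c ρ) + n ρ)
    top = trans (zipWith-row _∧_ c _ c≡p) (applyUpTo-cong p (λ ρ ρ<p → ∧-≤ᵇ M (n ρ) (bitAt c ρ) (n≤M ρ ρ<p)))
    rest : sorted (λ ρ → boolToℕ (bitAt c′ ρ) + n′ ρ) (suc M) ≡ sorted (λ ρ → boolToℕ (bitAt c ρ) + n ρ) (suc M)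
    rest = sorted-cong (suc M) λ ρ ρ<p k k<M → trans
      (cong (λ b → suc k ≤ᵇ boolToℕ b + n′ ρ)
            (trans (cong (λ t → bitAt t ρ) (zipWith-row _∨_ c _ c≡p)) (bitAt-applyUpTo _ ρ<p)))
      (∨-≤ᵇ M (n ρ) (bitAt c ρ) (n≤M ρ ρ<p) k<M)

  sortBySwaps : ∀ M u → length u ≡ M * p →
    Star (Swap p) u (sorted (beads 0 u) M) × (∀ ρ → ρ < p → beads 0 u ρ ≤ M)
  sortBySwaps zero    []  _   = ε , λ _ _ → z≤n
  sortBySwaps (suc M) u u≡Mp = swaps , bound
    where
    c = take p u
    u′ = drop p u
    c≡p : length c ≡ p
    c≡p = trans (length-take p u) (m≤n⇒m⊓n≡m (subst (p ≤_) (sym u≡Mp) (m≤m+n p (M * p))))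
    u′≡Mp : length u′ ≡ M * p
    u′≡Mp = trans (length-drop p u) (trans (cong (_∸ p) u≡Mp) (m+n∸m≡n p (M * p)))
    IH = sortBySwaps M u′ u′≡Mp
    beads-u : ∀ ρ → ρ < p → boolToℕ (bitAt c ρ) + beads 0 u′ ρ ≡ beads 0 u ρ
    beads-u ρ ρ<p = trans (sym (beads-row-++ c u′ ρ c≡p ρ<p)) (cong (λ w → beads 0 w ρ) (take++drop≡id p u))
    swaps : Star (Swap p) u (sorted (beads 0 u) (suc M))
    swaps = begin
      u                     ≡⟨ take++drop≡id p u ⟨
      c ++ u′               ⟶*⟨ swaps-++ˡ c (proj₁ IH) ⟩
      c ++ sorted (beads 0 u′) M ⟶*⟨ insertRow M (beads 0 u′) c c≡p (proj₂ IH) ⟩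
      sorted (λ ρ → boolToℕ (bitAt c ρ) + beads 0 u′ ρ) (suc M) ≡⟨ sorted-cong-≡ (suc M) beads-u ⟩
      sorted (beads 0 u) (suc M) ∎
      where open StarReasoning (Swap p)
    bound : ∀ ρ → ρ < p → beads 0 u ρ ≤ suc M
    bound ρ ρ<p = subst (_≤ suc M) (beads-u ρ ρ<p) (bit+≤ (bitAt c ρ) (proj₂ IH ρ ρ<p))
      where
      bit+≤ : ∀ b {a} → a ≤ M → boolToℕ b + a ≤ suc M
      bit+≤ true  = s≤s
      bit+≤ false = m≤n⇒m≤1+n

  -- Rectangular cores

  coreWord : ℕ → ℕ → List Bool → List Bool
  coreWord K q P = replicate (K * p) false ++ P ++ replicate (q * p) true

  sorted-coreWord : ∀ K q P → length P ≡ p → sorted (λ ρ → boolToℕ (bitAt P ρ) + q) (K + suc q) ≡ coreWord K q P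
  sorted-coreWord K q P P≡p = trans (empty K) (cong (replicate (K * p) false ++_) (cong₂ _++_ middle (full q ≤-refl)))
    where
    n : ℕ → ℕ
    n ρ = boolToℕ (bitAt P ρ) + q
    n≤1+q : ∀ b → boolToℕ b + q ≤ suc q
    n≤1+q true  = ≤-refl
    n≤1+q false = n≤1+n q
    empty : ∀ K → sorted n (K + suc q) ≡ replicate (K * p) false ++ sorted n (suc q)
    empty zero    = refl
    empty (suc K) = begin
      row (λ ρ → suc (K + suc q) ≤ᵇ n ρ) ++ sorted n (K + suc q)
        ≡⟨ cong₂ _++_ (trans (applyUpTo-cong p λ ρ _ →
                                ≤ᵇ-false (s≤s (≤-trans (n≤1+q (bitAt P ρ)) (m≤n+m (suc q) K))))
                              (applyUpTo-const false p))
                      (empty K) ⟩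
      replicate p false ++ replicate (K * p) false ++ sorted n (suc q)
        ≡⟨ ++-assoc (replicate p false) _ _ ⟨
      (replicate p false ++ replicate (K * p) false) ++ sorted n (suc q)
        ≡⟨ cong (_++ sorted n (suc q)) (replicate-+ false p (K * p)) ⟨
      replicate (suc K * p) false ++ sorted n (suc q) ∎
      where open ≡-Reasoning
    threshold : ∀ b → (suc q ≤ᵇ boolToℕ b + q) ≡ b
    threshold true  = ≤ᵇ-true {suc q} ≤-refl
    threshold false = ≤ᵇ-false {suc q} ≤-refl
    middle : row (λ ρ → suc q ≤ᵇ n ρ) ≡ P
    middle = trans (applyUpTo-cong p λ ρ _ → threshold (bitAt P ρ)) (sym (row-bitAt P P≡p))
    full : ∀ j → j ≤ q → sorted n j ≡ replicate (j * p) true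
    full zero    _   = refl
    full (suc j) j≤q = trans
      (cong₂ _++_ (trans (applyUpTo-cong p λ ρ _ → ≤ᵇ-true (≤-trans j≤q (m≤n+m q (boolToℕ (bitAt P ρ)))))
                         (applyUpTo-const true p))
                  (full j (≤-trans (n≤1+n j) j≤q)))
      (sym (replicate-+ true p (j * p)))

  -- s beads on the runners e - s, …, e - 1, read cyclically.
  record IntervalRow (s e : ℕ) : Set where
    field
      cells        : List Bool
      length-cells : length cells ≡ p
      beads-cells  : ∀ o ρ → (o + s) % p ≡ e % p → beads 0 cells ρ ≡ beads o (replicate s true) ρ
      shape-cells  : ∀ K m → shape (replicate K false ++ cells ++ replicate m true) ≡ rect (p ∸ (s ⊔ e)) (s ⊓ e)

  intervalRow-≤ : ∀ {s e} → s ≤ e → e < p → IntervalRow s e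
  intervalRow-≤ {s} {e} s≤e e<p = record
    { cells        = cells
    ; length-cells = length-cells
    ; beads-cells  = beads-cells
    ; shape-cells  = shape-cells
    }
    where
    cells = replicate (e ∸ s) false ++ replicate s true ++ replicate (p ∸ e) false
    length-cells : length cells ≡ p
    length-cells = begin
      length cells                  ≡⟨ length-++ (replicate (e ∸ s) false) ⟩
      length (replicate (e ∸ s) false) + length (replicate s true ++ replicate (p ∸ e) false)
                                    ≡⟨ cong₂ _+_ (length-replicate (e ∸ s)) (trans (length-++ (replicate s true))
                                         (cong₂ _+_ (length-replicate s) (length-replicate (p ∸ e)))) ⟩
      (e ∸ s) + (s + (p ∸ e))       ≡⟨ +-assoc (e ∸ s) s _ ⟨
      (e ∸ s) + s + (p ∸ e)         ≡⟨ cong (_+ (p ∸ e)) (m∸n+n≡m s≤e) ⟩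
      e + (p ∸ e)                   ≡⟨ m+[n∸m]≡n (<⇒≤ e<p) ⟩
      p                             ∎
      where open ≡-Reasoning
    beads-cells : ∀ o ρ → (o + s) % p ≡ e % p → beads 0 cells ρ ≡ beads o (replicate s true) ρ
    beads-cells o ρ o+s≡e = begin
      beads 0 cells ρ                                              ≡⟨ beads-falses-++ 0 (e ∸ s) _ ρ ⟩
      beads (e ∸ s) (replicate s true ++ replicate (p ∸ e) false) ρ ≡⟨ beads-trues-++ (e ∸ s) s _ ρ ⟩
      beads (e ∸ s) (replicate s true) ρ + beads (e ∸ s + s) (replicate (p ∸ e) false) ρ
        ≡⟨ cong (beads (e ∸ s) (replicate s true) ρ +_) (beads-falses _ (p ∸ e) ρ) ⟩
      beads (e ∸ s) (replicate s true) ρ + 0                       ≡⟨ +-identityʳ _ ⟩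
      beads (e ∸ s) (replicate s true) ρ                           ≡⟨ beads-cong e∸s≡o (replicate s true) ρ ⟩
      beads o (replicate s true) ρ                                 ∎
      where
      open ≡-Reasoning
      e∸s≡o : (e ∸ s) % p ≡ o % p
      e∸s≡o = %-cancel-+ʳ s p (trans (cong (_% p) (m∸n+n≡m s≤e)) (sym o+s≡e))
    shape-cells : ∀ K m → shape (replicate K false ++ cells ++ replicate m true) ≡ rect (p ∸ (s ⊔ e)) (s ⊓ e)
    shape-cells K m = begin
      shape (replicate K false ++ cells ++ replicate m true)
        ≡⟨ shape-falses-++ K _ ⟩
      shape (cells ++ replicate m true)
        ≡⟨ cong shape (++-assoc (replicate (e ∸ s) false) _ _) ⟩
      shape (replicate (e ∸ s) false ++ (replicate s true ++ replicate (p ∸ e) false) ++ replicate m true)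
        ≡⟨ shape-falses-++ (e ∸ s) _ ⟩
      shape ((replicate s true ++ replicate (p ∸ e) false) ++ replicate m true)
        ≡⟨ cong shape (++-assoc (replicate s true) _ _) ⟩
      shape (replicate s true ++ replicate (p ∸ e) false ++ replicate m true)
        ≡⟨ shape-rect s (p ∸ e) m (m<n⇒0<n∸m e<p) ⟩
      rect (p ∸ e) s
        ≡⟨ cong₂ rect (cong (p ∸_) (m≤n⇒m⊔n≡n s≤e)) (m≤n⇒m⊓n≡m s≤e) ⟨
      rect (p ∸ (s ⊔ e)) (s ⊓ e) ∎
      where open ≡-Reasoning

  intervalRow-> : ∀ {s e} → e < s → s < p → IntervalRow s e
  intervalRow-> {s} {e} e<s s<p = record
    { cells        = cells
    ; length-cells = length-cells
    ; beads-cells  = beads-cells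
    ; shape-cells  = shape-cells
    }
    where
    e≤s = <⇒≤ e<s
    cells = replicate e true ++ replicate (p ∸ s) false ++ replicate (s ∸ e) true
    length-cells : length cells ≡ p
    length-cells = begin
      length cells                  ≡⟨ length-++ (replicate e true) ⟩
      length (replicate e true) + length (replicate (p ∸ s) false ++ replicate (s ∸ e) true)
                                    ≡⟨ cong₂ _+_ (length-replicate e) (trans (length-++ (replicate (p ∸ s) false))
                                         (cong₂ _+_ (length-replicate (p ∸ s)) (length-replicate (s ∸ e)))) ⟩
      e + ((p ∸ s) + (s ∸ e))       ≡⟨ +-comm e _ ⟩
      (p ∸ s) + (s ∸ e) + e         ≡⟨ +-assoc (p ∸ s) _ e ⟩
      (p ∸ s) + (s ∸ e + e)         ≡⟨ cong ((p ∸ s) +_) (m∸n+n≡m e≤s) ⟩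
      (p ∸ s) + s                   ≡⟨ m∸n+n≡m (<⇒≤ s<p) ⟩
      p                             ∎
      where open ≡-Reasoning
    beads-cells : ∀ o ρ → (o + s) % p ≡ e % p → beads 0 cells ρ ≡ beads o (replicate s true) ρ
    beads-cells o ρ o+s≡e = begin
      beads 0 cells ρ
        ≡⟨ beads-trues-++ 0 e _ ρ ⟩
      beads 0 (replicate e true) ρ + beads e (replicate (p ∸ s) false ++ replicate (s ∸ e) true) ρ
        ≡⟨ cong₂ _+_ (beads-cong (sym o+[s∸e]≡0) (replicate e true) ρ)
                     (trans (beads-falses-++ e (p ∸ s) _ ρ) (beads-cong (sym o≡e+[p∸s]) (replicate (s ∸ e) true) ρ)) ⟩
      beads (o + (s ∸ e)) (replicate e true) ρ + beads o (replicate (s ∸ e) true) ρ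
        ≡⟨ +-comm (beads (o + (s ∸ e)) (replicate e true) ρ) _ ⟩
      beads o (replicate (s ∸ e) true) ρ + beads (o + (s ∸ e)) (replicate e true) ρ
        ≡⟨ beads-trues-+ o (s ∸ e) e ρ ⟨
      beads o (replicate (s ∸ e + e) true) ρ
        ≡⟨ cong (λ n → beads o (replicate n true) ρ) (m∸n+n≡m e≤s) ⟩
      beads o (replicate s true) ρ ∎
      where
      open ≡-Reasoning
      o≡e+[p∸s] : o % p ≡ (e + (p ∸ s)) % p
      o≡e+[p∸s] = %-cancel-+ʳ s p (begin
        (o + s) % p             ≡⟨ o+s≡e ⟩
        e % p                   ≡⟨ [m+n]%n≡m%n e p ⟨
        (e + p) % p             ≡⟨ cong (λ t → (e + t) % p) (m∸n+n≡m (<⇒≤ s<p)) ⟨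
        (e + (p ∸ s + s)) % p   ≡⟨ cong (_% p) (+-assoc e (p ∸ s) s) ⟨
        (e + (p ∸ s) + s) % p   ∎)
      o+[s∸e]≡0 : (o + (s ∸ e)) % p ≡ 0 % p
      o+[s∸e]≡0 = %-cancel-+ʳ e p (trans (cong (_% p) (trans (+-assoc o (s ∸ e) e) (cong (o +_) (m∸n+n≡m e≤s)))) o+s≡e)
    shape-cells : ∀ K m → shape (replicate K false ++ cells ++ replicate m true) ≡ rect (p ∸ (s ⊔ e)) (s ⊓ e)
    shape-cells K m = begin
      shape (replicate K false ++ cells ++ replicate m true)
        ≡⟨ shape-falses-++ K _ ⟩
      shape (cells ++ replicate m true)
        ≡⟨ cong shape (++-assoc (replicate e true) _ _) ⟩
      shape (replicate e true ++ (replicate (p ∸ s) false ++ replicate (s ∸ e) true) ++ replicate m true)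
        ≡⟨ cong (λ w → shape (replicate e true ++ w)) (++-assoc (replicate (p ∸ s) false) _ _) ⟩
      shape (replicate e true ++ replicate (p ∸ s) false ++ replicate (s ∸ e) true ++ replicate m true)
        ≡⟨ cong (λ w → shape (replicate e true ++ replicate (p ∸ s) false ++ w)) (replicate-+ true (s ∸ e) m) ⟨
      shape (replicate e true ++ replicate (p ∸ s) false ++ replicate (s ∸ e + m) true)
        ≡⟨ shape-rect e (p ∸ s) (s ∸ e + m) (m<n⇒0<n∸m s<p) ⟩
      rect (p ∸ s) e
        ≡⟨ cong₂ rect (cong (p ∸_) (m≥n⇒m⊔n≡m e≤s)) (m≥n⇒m⊓n≡n e≤s) ⟨
      rect (p ∸ (s ⊔ e)) (s ⊓ e) ∎
      where open ≡-Reasoning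

  intervalRow : ∀ {s e} → s < p → e < p → IntervalRow s e
  intervalRow {s} {e} s<p e<p with s ≤? e
  ... | yes s≤e = intervalRow-≤ s≤e e<p
  ... | no  s≰e = intervalRow-> (≰⇒> s≰e) s<p

  coreOfInterval : ∀ {M r e} u → length u ≡ M * p → r / p < M → e < p →
    (∀ o ρ → (o + r) % p ≡ e % p → beads 0 u ρ ≡ beads o (replicate r true) ρ) →
    IsCoreOf p (shape u) (rect (p ∸ (r % p ⊔ e)) (r % p ⊓ e))
  coreOfInterval {M} {r} {e} u u≡Mp q<M e<p beads-u =
    subst (Star (RemovesRimHook p) (shape u)) (shape-cells (K * p) (q * p))
      (gmap shape swap⇒removesRimHook (subst (Star (Swap p) u) sorted≡ (proj₁ (sortBySwaps M u u≡Mp))))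
    , rect-noRimHook p (p ∸ (s ⊔ e)) (s ⊓ e) (m<n⇒0<n∸m (⊔-lub s<p e<p)) sides≤p
    where
    s = r % p
    q = r / p
    s<p : s < p
    s<p = m%n<n r p
    open IntervalRow (intervalRow s<p e<p)
    K = M ∸ suc q
    o = e + (p ∸ s)
    o+r≡e : (o + r) % p ≡ e % p
    o+r≡e = begin
      (o + r) % p           ≡⟨ cong (λ t → (o + t) % p) (m≡m%n+[m/n]*n r p) ⟩
      (o + (s + q * p)) % p ≡⟨ cong (_% p) (+-assoc o s (q * p)) ⟨
      (o + s + q * p) % p   ≡⟨ [m+kn]%n≡m%n (o + s) q p ⟩
      (e + (p ∸ s) + s) % p ≡⟨ cong (_% p) (trans (+-assoc e (p ∸ s) s) (cong (e +_) (m∸n+n≡m (<⇒≤ s<p)))) ⟩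
      (e + p) % p           ≡⟨ [m+n]%n≡m%n e p ⟩
      e % p                 ∎
      where open ≡-Reasoning
    o+s≡e : (o + s) % p ≡ e % p
    o+s≡e = trans (sym ([m+kn]%n≡m%n (o + s) q p))
      (trans (cong (_% p) (trans (+-assoc o s (q * p)) (cong (o +_) (sym (m≡m%n+[m/n]*n r p))))) o+r≡e)
    beads≡ : ∀ ρ → ρ < p → beads 0 u ρ ≡ boolToℕ (bitAt cells ρ) + q
    beads≡ ρ ρ<p = begin
      beads 0 u ρ                                              ≡⟨ beads-u o ρ o+r≡e ⟩
      beads o (replicate r true) ρ
        ≡⟨ cong (λ n → beads o (replicate n true) ρ) (m≡m%n+[m/n]*n r p) ⟩
      beads o (replicate (s + q * p) true) ρ                   ≡⟨ beads-trues-+ o s (q * p) ρ ⟩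
      beads o (replicate s true) ρ + beads (o + s) (replicate (q * p) true) ρ
        ≡⟨ cong₂ _+_ (sym (beads-cells o ρ o+s≡e)) (beads-periods q (o + s) ρ ρ<p) ⟩
      beads 0 cells ρ + q                                      ≡⟨ cong (_+ q) (beads-row cells ρ length-cells ρ<p) ⟩
      boolToℕ (bitAt cells ρ) + q                              ∎
      where open ≡-Reasoning
    sorted≡ : sorted (beads 0 u) M ≡ coreWord K q cells
    sorted≡ = begin
      sorted (beads 0 u) M                                         ≡⟨ sorted-cong-≡ M beads≡ ⟩
      sorted (λ ρ → boolToℕ (bitAt cells ρ) + q) M                 ≡⟨ cong (sorted _) (m∸n+n≡m q<M) ⟨
      sorted (λ ρ → boolToℕ (bitAt cells ρ) + q) (K + suc q)       ≡⟨ sorted-coreWord K q cells length-cells ⟩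
      coreWord K q cells                                           ∎
      where open ≡-Reasoning
    sides≤p : p ∸ (s ⊔ e) + s ⊓ e ≤ p
    sides≤p = ≤-trans (+-monoʳ-≤ (p ∸ (s ⊔ e)) (m⊓n≤m⊔n s e)) (≤-reflexive (m∸n+n≡m (<⇒≤ (⊔-lub s<p e<p))))

  -- JS-partitions

  -- The JS condition moves each block of `true`s, by a multiple of p, against the next one.
  beads-groupsWord : ∀ G {o o′ R} → JSCond p G → ones (groupsWord G) ≡ R →
    (o′ + R) % p ≡ (o + headMultiplicity G) % p → ∀ ρ → beads o (groupsWord G) ρ ≡ beads o′ (replicate R true) ρ
  beads-groupsWord [] _ refl _ ρ = refl
  beads-groupsWord ((l , a) ∷ []) {o} {o′} {R} _ ones≡R o′+R≡o+a ρ = begin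
    beads o (replicate a true ++ replicate l false) ρ                ≡⟨ beads-trues-++ o a _ ρ ⟩
    beads o (replicate a true) ρ + beads (o + a) (replicate l false) ρ ≡⟨ cong (_ +_) (beads-falses (o + a) l ρ) ⟩
    beads o (replicate a true) ρ + 0                                  ≡⟨ +-identityʳ _ ⟩
    beads o (replicate a true) ρ                                      ≡⟨ beads-cong o≡o′ (replicate a true) ρ ⟩
    beads o′ (replicate a true) ρ                                     ≡⟨ cong (λ n → beads o′ (replicate n true) ρ) a≡R ⟩
    beads o′ (replicate R true) ρ                                     ∎
    where
    open ≡-Reasoning
    a≡R : a ≡ R
    a≡R = trans (sym (trans (ones-trues-++ a _) (trans (cong (a +_) (ones-falses l)) (+-identityʳ a)))) ones≡R
    o≡o′ : o % p ≡ o′ % p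
    o≡o′ = sym (%-cancel-+ʳ a p (subst (λ n → (o′ + n) % p ≡ (o + a) % p) (sym a≡R) o′+R≡o+a))
  beads-groupsWord ((l , a) ∷ (l′ , a′) ∷ G) {o} {o′} {R} (p∣l-l′+a+a′ , js) ones≡R o′+R≡o+a ρ = begin
    beads o (replicate a true ++ replicate (l ∸ l′) false ++ W′) ρ
      ≡⟨ beads-trues-++ o a _ ρ ⟩
    beads o (replicate a true) ρ + beads (o + a) (replicate (l ∸ l′) false ++ W′) ρ
      ≡⟨ cong (_ +_) (beads-falses-++ (o + a) (l ∸ l′) W′ ρ) ⟩
    beads o (replicate a true) ρ + beads (o + a + (l ∸ l′)) W′ ρ
      ≡⟨ cong (_ +_) (beads-groupsWord ((l′ , a′) ∷ G) js refl o′+R′≡next ρ) ⟩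
    beads o (replicate a true) ρ + beads o′ (replicate R′ true) ρ
      ≡⟨ +-comm (beads o (replicate a true) ρ) _ ⟩
    beads o′ (replicate R′ true) ρ + beads o (replicate a true) ρ
      ≡⟨ cong (beads o′ (replicate R′ true) ρ +_) (beads-cong (sym o′+R′≡o) (replicate a true) ρ) ⟩
    beads o′ (replicate R′ true) ρ + beads (o′ + R′) (replicate a true) ρ
      ≡⟨ beads-trues-+ o′ R′ a ρ ⟨
    beads o′ (replicate (R′ + a) true) ρ
      ≡⟨ cong (λ n → beads o′ (replicate n true) ρ) R′+a≡R ⟩
    beads o′ (replicate R true) ρ ∎
    where
    open ≡-Reasoning
    W′ = groupsWord ((l′ , a′) ∷ G)
    R′ = ones W′
    R′+a≡R : R′ + a ≡ R
    R′+a≡R = trans (+-comm R′ a)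
      (trans (sym (trans (ones-trues-++ a _) (cong (a +_) (ones-falses-++ (l ∸ l′) W′)))) ones≡R)
    o′+R′≡o : (o′ + R′) % p ≡ o % p
    o′+R′≡o = %-cancel-+ʳ a p
      (subst (λ n → n % p ≡ (o + a) % p) (sym (trans (+-assoc o′ R′ a) (cong (o′ +_) R′+a≡R))) o′+R≡o+a)
    o′+R′≡next : (o′ + R′) % p ≡ (o + a + (l ∸ l′) + a′) % p
    o′+R′≡next = trans o′+R′≡o (sym (trans (cong (_% p) (regroup o a (l ∸ l′) a′)) (%-remove-+ʳ o p∣l-l′+a+a′)))
      where
      regroup : ∀ o a d a′ → o + a + d + a′ ≡ o + (d + a + a′)
      regroup = solve-∀

  record RectangularCore (λ′ : Partition) (α : ℕ) : Set where
    field
      e       : ℕ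
      e<p     : e < p
      e+α+r≡0 : (e + (α + length λ′)) % p ≡ 0
      isCore  : IsCoreOf p λ′ (rect (p ∸ (length λ′ % p ⊔ e)) (length λ′ % p ⊓ e))

  jsCore : ∀ λ′ α → IsJSOfType p λ′ (ℤ.+ α) → RectangularCore λ′ α
  jsCore λ′ α js with groups λ′ in groups≡ | js
  ... | (l₁ , a₁) ∷ G | isPart , _ , jsCond , type = record
    { e       = e
    ; e<p     = m%n<n (x + a₁) p
    ; e+α+r≡0 = e+α+r≡0
    ; isCore  = subst (λ μ → IsCoreOf p μ (rect (p ∸ (r % p ⊔ e)) (r % p ⊓ e))) shape-u
                  (coreOfInterval u length-u r/p<M (m%n<n (x + a₁) p) beads-u)
    }
    where
    W = groupsWord ((l₁ , a₁) ∷ G)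
    r = length λ′
    M = r + l₁
    -- Padding with falses makes u exactly M rows long without changing its shape.
    x = M * p ∸ M
    u = replicate x false ++ W
    -- After sliding, the r beads end where the first block of `true`s of u ends.
    e = (x + a₁) % p
    W-facts : shape W ≡ λ′ × zeros W ≡ part λ′ 0 × ones W ≡ r
    W-facts = subst (λ G′ → shape (groupsWord G′) ≡ λ′ × zeros (groupsWord G′) ≡ part λ′ 0 × ones (groupsWord G′) ≡ r)
                groups≡ (groupsWord-groups λ′ isPart)
    zeros-W : zeros W ≡ l₁
    zeros-W = trans (proj₁ (proj₂ W-facts)) (trans (sym (headPart-groups λ′)) (cong headPart groups≡))
    shape-u : shape u ≡ λ′
    shape-u = trans (shape-falses-++ x W) (proj₁ W-facts)
    length-u : length u ≡ M * p
    length-u = begin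
      length u            ≡⟨ length-++ (replicate x false) ⟩
      length (replicate x false) + length W ≡⟨ cong₂ _+_ (length-replicate x) (length≡ones+zeros W) ⟩
      x + (ones W + zeros W) ≡⟨ cong (x +_) (cong₂ _+_ (proj₂ (proj₂ W-facts)) zeros-W) ⟩
      x + M               ≡⟨ m∸n+n≡m (m≤m*n M p) ⟩
      M * p               ∎
      where open ≡-Reasoning
    r/p<M : r / p < M
    r/p<M = ≤-trans (s≤s (m/n≤m r p)) (subst (_≤ M) (+-comm r 1) (+-monoʳ-≤ r (1≤headPart λ′ groups≡ (proj₂ isPart))))
    l₁≡a₁+α : l₁ % p ≡ (a₁ + α) % p
    l₁≡a₁+α = Equivalence.to (sub-mod⇔%≡ {l₁} {a₁} {α} p) type
    e+α+r≡0 : (e + (α + r)) % p ≡ 0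
    e+α+r≡0 = begin
      (e + (α + r)) % p         ≡⟨ %-cong-+ʳ (α + r) p (m%n%n≡m%n (x + a₁) p) ⟩
      (x + a₁ + (α + r)) % p    ≡⟨ cong (_% p) (regroup x a₁ α r) ⟩
      (x + (a₁ + α) + r) % p    ≡⟨ %-cong-+ʳ r p (%-cong-+ˡ x p l₁≡a₁+α) ⟨
      (x + l₁ + r) % p          ≡⟨ cong (_% p) (trans (+-assoc x l₁ r) (cong (x +_) (+-comm l₁ r))) ⟩
      (x + M) % p               ≡⟨ cong (_% p) (m∸n+n≡m (m≤m*n M p)) ⟩
      (M * p) % p               ≡⟨ m*n%n≡0 M p ⟩
      0                         ∎
      where
      open ≡-Reasoning
      regroup : ∀ x a α r → x + a + (α + r) ≡ x + (a + α) + r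
      regroup = solve-∀
    beads-u : ∀ o ρ → (o + r) % p ≡ e % p → beads 0 u ρ ≡ beads o (replicate r true) ρ
    beads-u o ρ o+r≡e = trans (beads-falses-++ 0 x W ρ)
      (beads-groupsWord ((l₁ , a₁) ∷ G) jsCond (proj₂ (proj₂ W-facts)) (trans o+r≡e (m%n%n≡m%n (x + a₁) p)) ρ)

  -- Reading the core off the residue symbol

  0%p≡0 : 0 % p ≡ 0
  0%p≡0 = m<n⇒m%n≡m (>-nonZero⁻¹ p)

  %≡⇒≡ : ∀ {a b} → a < p → b < p → a % p ≡ b % p → a ≡ b
  %≡⇒≡ a<p b<p a≡b = trans (sym (m<n⇒m%n≡m a<p)) (trans a≡b (m<n⇒m%n≡m b<p))

  mod⇒%≡-via : ∀ x y {m n} → x ℤ.- y ≡ ℤ.+ m ℤ.- ℤ.+ n → x ≡ y [mod p ] → m % p ≡ n % p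
  mod⇒%≡-via x y {m} {n} x-y≡m-n = Equivalence.to (mod⇔%≡ {m} {n} p) ∘ subst (λ z → p ∣ abs z) x-y≡m-n

  1-r≡α-l+1⇒l≡r+α : ∀ {α l r} → (ℤ.+ 1 ℤ.- ℤ.+ r) ≡ ℤ.+ α ℤ.- ℤ.+ l ℤ.+ ℤ.+ 1 [mod p ] →
    l % p ≡ (r + α) % p
  1-r≡α-l+1⇒l≡r+α {α} {l} {r} = mod⇒%≡-via (ℤ.+ 1 ℤ.- ℤ.+ r) (ℤ.+ α ℤ.- ℤ.+ l ℤ.+ ℤ.+ 1) {l} {r + α}
    (trans (regroup (ℤ.+ r) (ℤ.+ α) (ℤ.+ l)) (cong (λ z → ℤ.+ l ℤ.- z) (sym (ℤP.pos-+ r α))))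
    where
    regroup : ∀ r α l → ℤ.+ 1 ℤ.- r ℤ.- (α ℤ.- l ℤ.+ ℤ.+ 1) ≡ l ℤ.- (r ℤ.+ α)
    regroup = ℤ-Solver.solve-∀

  1-r≡l+1⇒r+l≡0 : ∀ {l r} → (ℤ.+ 1 ℤ.- ℤ.+ r) ≡ ℤ.+ l ℤ.+ ℤ.+ 1 [mod p ] → (r + l) % p ≡ 0
  1-r≡l+1⇒r+l≡0 {l} {r} y≡ = trans (sym (mod⇒%≡-via (ℤ.+ 1 ℤ.- ℤ.+ r) (ℤ.+ l ℤ.+ ℤ.+ 1) {0} {r + l}
    (trans (regroup (ℤ.+ r) (ℤ.+ l)) (cong (λ z → ℤ.+ 0 ℤ.- z) (sym (ℤP.pos-+ r l)))) y≡)) 0%p≡0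
    where
    regroup : ∀ r l → ℤ.+ 1 ℤ.- r ℤ.- (l ℤ.+ ℤ.+ 1) ≡ ℤ.+ 0 ℤ.- (r ℤ.+ l)
    regroup = ℤ-Solver.solve-∀

  -- The first entries are not needed: the four options give y ≡ α - l + 1 or y ≡ l + 1.
  inSetL-residues : ∀ {α l r} x {y} → y ≡ ℤ.+ 1 ℤ.- ℤ.+ r → InSetL p (ℤ.+ α) (ℤ.+ l) (x , y) →
    l % p ≡ (r + α) % p ⊎ (r + l) % p ≡ 0
  inSetL-residues {α} {l} {r} _ refl (inj₁ (_ , y≡))                = inj₁ (1-r≡α-l+1⇒l≡r+α {α} {l} {r} y≡)
  inSetL-residues {α} {l} {r} _ refl (inj₂ (inj₁ (_ , y≡)))        = inj₂ (1-r≡l+1⇒r+l≡0 {l} {r} y≡)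
  inSetL-residues {α} {l} {r} _ refl (inj₂ (inj₂ (inj₁ (_ , y≡)))) = inj₂ (1-r≡l+1⇒r+l≡0 {l} {r} y≡)
  inSetL-residues {α} {l} {r} _ refl (inj₂ (inj₂ (inj₂ (_ , y≡)))) = inj₁ (1-r≡α-l+1⇒l≡r+α {α} {l} {r} y≡)

  RectSides : ℕ → ℕ → ℕ → Set
  RectSides α l t = 1 ≤ l × l ≤ p × t < p × t ≤ p ∸ l × (t + α) % p ≡ l % p

  module _ {λ′ α} (C : RectangularCore λ′ α) where
    open RectangularCore C
    private
      r = length λ′
      s = r % p
      s<p : s < p
      s<p = m%n<n r p
      s≡r : s % p ≡ r % p
      s≡r = m%n%n≡m%n r p

    core-type : (ℤ.+ (p ∸ (s ⊔ e)) ℤ.- ℤ.+ (s ⊓ e)) ≡ ℤ.+ α [mod p ]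
    core-type = Equivalence.from (sub-mod⇔%≡ {p ∸ (s ⊔ e)} {s ⊓ e} {α} p) (%-cancel-+ʳ (s ⊔ e) p (begin
      (p ∸ (s ⊔ e) + (s ⊔ e)) % p   ≡⟨ cong (_% p) (m∸n+n≡m (<⇒≤ (⊔-lub s<p e<p))) ⟩
      p % p                       ≡⟨ n%n≡0 p ⟩
      0                           ≡⟨ e+α+r≡0 ⟨
      (e + (α + r)) % p           ≡⟨ cong (_% p) (regroup e α r) ⟩
      (r + (e + α)) % p           ≡⟨ %-cong-+ʳ (e + α) p s≡r ⟨
      (s + (e + α)) % p           ≡⟨ cong (_% p) (trans (sym (+-assoc s e α)) (cong (_+ α) (sym (⊓+⊔ s e)))) ⟩
      (s ⊓ e + (s ⊔ e) + α) % p     ≡⟨ cong (_% p) (regroup′ (s ⊓ e) (s ⊔ e) α) ⟩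
      (s ⊓ e + α + (s ⊔ e)) % p     ∎))
      where
      open ≡-Reasoning
      regroup : ∀ e α r → e + (α + r) ≡ r + (e + α)
      regroup = solve-∀
      regroup′ : ∀ a b α → a + b + α ≡ a + α + b
      regroup′ = solve-∀

    residue-pair : ∀ {l t} → RectSides α l t → l % p ≡ (r + α) % p ⊎ (r + l) % p ≡ 0 →
      (s ≡ t × e ≡ p ∸ l) ⊎ (s ≡ p ∸ l × e ≡ t)
    residue-pair {l} {t} (1≤l , l≤p , t<p , _ , t+α≡l) (inj₁ l≡r+α) = inj₁ (s≡t , e≡p∸l)
      where
      open ≡-Reasoning
      s≡t : s ≡ t
      s≡t = %≡⇒≡ s<p t<p (%-cancel-+ʳ α p (begin
        (s + α) % p  ≡⟨ %-cong-+ʳ α p s≡r ⟩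
        (r + α) % p  ≡⟨ l≡r+α ⟨
        l % p        ≡⟨ t+α≡l ⟨
        (t + α) % p  ∎))
      e≡p∸l : e ≡ p ∸ l
      e≡p∸l = %≡⇒≡ e<p (∸-monoʳ-< 1≤l l≤p) (%-cancel-+ʳ l p (begin
        (e + l) % p        ≡⟨ %-cong-+ˡ e p l≡r+α ⟩
        (e + (r + α)) % p  ≡⟨ cong (λ z → (e + z) % p) (+-comm r α) ⟩
        (e + (α + r)) % p  ≡⟨ e+α+r≡0 ⟩
        0                  ≡⟨ n%n≡0 p ⟨
        p % p              ≡⟨ cong (_% p) (m∸n+n≡m l≤p) ⟨
        (p ∸ l + l) % p    ∎))
    residue-pair {l} {t} (1≤l , l≤p , t<p , _ , t+α≡l) (inj₂ r+l≡0) = inj₂ (s≡p∸l , e≡t)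
      where
      open ≡-Reasoning
      s≡p∸l : s ≡ p ∸ l
      s≡p∸l = %≡⇒≡ s<p (∸-monoʳ-< 1≤l l≤p) (%-cancel-+ʳ l p (begin
        (s + l) % p        ≡⟨ %-cong-+ʳ l p s≡r ⟩
        (r + l) % p        ≡⟨ r+l≡0 ⟩
        0                  ≡⟨ n%n≡0 p ⟨
        p % p              ≡⟨ cong (_% p) (m∸n+n≡m l≤p) ⟨
        (p ∸ l + l) % p    ∎))
      e≡t : e ≡ t
      e≡t = %≡⇒≡ e<p t<p (%-cancel-+ʳ α p (begin
        (e + α) % p                ≡⟨ cong (_% p) (+-identityʳ (e + α)) ⟨
        (e + α + 0) % p            ≡⟨ %-cong-+ˡ (e + α) p (trans r+l≡0 (sym 0%p≡0)) ⟨
        (e + α + (r + l)) % p      ≡⟨ cong (_% p) (regroup e α r l) ⟩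
        (e + (α + r) + l) % p      ≡⟨ %-cong-+ʳ l p (trans e+α+r≡0 (sym 0%p≡0)) ⟩
        l % p                      ≡⟨ t+α≡l ⟨
        (t + α) % p                ∎))
        where
        regroup : ∀ e α r l → e + α + (r + l) ≡ e + (α + r) + l
        regroup = solve-∀

    core-rect : ∀ {l t} x {y} → RectSides α l t → y ≡ ℤ.+ 1 ℤ.- ℤ.+ r → InSetL p (ℤ.+ α) (ℤ.+ l) (x , y) →
      IsCoreOf p λ′ (rect l t)
    core-rect {l} {t} x sides@(_ , l≤p , _ , t≤p∸l , _) y≡ inSet = subst (IsCoreOf p λ′) (begin
      rect (p ∸ (s ⊔ e)) (s ⊓ e)  ≡⟨ rect-⊔-⊓ p t≤p∸l (residue-pair sides (inSetL-residues x y≡ inSet)) ⟩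
      rect (p ∸ (p ∸ l)) t        ≡⟨ cong (λ L → rect L t) (m∸[m∸n]≡n l≤p) ⟩
      rect l t                    ∎) isCore
      where open ≡-Reasoning

    core-empty : ∀ x {y} → y ≡ ℤ.+ 1 ℤ.- ℤ.+ r → InSetL p (ℤ.+ α) (ℤ.+ 0) (x , y) → IsCoreOf p λ′ []
    core-empty x y≡ inSet = subst (λ A → IsCoreOf p λ′ (rect (p ∸ (s ⊔ e)) A)) (min≡0 (inSetL-residues x y≡ inSet)) isCore
      where
      min≡0 : 0 % p ≡ (r + α) % p ⊎ (r + 0) % p ≡ 0 → s ⊓ e ≡ 0
      min≡0 (inj₁ 0≡r+α) = trans (cong (s ⊓_) e≡0) (⊓-zeroʳ s)
        where
        e≡0 : e ≡ 0
        e≡0 = %≡⇒≡ e<p (>-nonZero⁻¹ p) (%-cancel-+ʳ (α + r) p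
          (trans e+α+r≡0 (trans (sym 0%p≡0) (trans 0≡r+α (cong (_% p) (+-comm r α))))))
      min≡0 (inj₂ r+0≡0) = cong (_⊓ e) (trans (cong (_% p) (sym (+-identityʳ r))) r+0≡0)

  rectSides-2l≤α : ∀ {α l} → α < p → 1 ≤ l → 2 * l ≤ α → RectSides α l (p + l ∸ α)
  rectSides-2l≤α {α} {l} α<p 1≤l 2l≤α = 1≤l , <⇒≤ (<-trans l<α α<p) , t<p , t≤p∸l , t+α≡l
    where
    l+l≤α : l + l ≤ α
    l+l≤α = subst (_≤ α) (cong (l +_) (+-identityʳ l)) 2l≤α
    l<α : l < α
    l<α = ≤-trans (subst (_≤ l + l) (+-comm l 1) (+-monoʳ-≤ l 1≤l)) l+l≤α
    t+α≡p+l : p + l ∸ α + α ≡ p + l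
    t+α≡p+l = m∸n+n≡m (≤-trans (<⇒≤ α<p) (m≤m+n p l))
    t<p : p + l ∸ α < p
    t<p = +-cancelʳ-< α (p + l ∸ α) p (subst (_< p + α) (sym t+α≡p+l) (+-monoʳ-< p l<α))
    t≤p∸l : p + l ∸ α ≤ p ∸ l
    t≤p∸l = ≤-trans (∸-monoʳ-≤ (p + l) l+l≤α)
      (≤-reflexive (trans (cong (_∸ (l + l)) (+-comm p l)) ([m+n]∸[m+o]≡n∸o l p l)))
    t+α≡l : (p + l ∸ α + α) % p ≡ l % p
    t+α≡l = trans (cong (_% p) (trans t+α≡p+l (+-comm p l))) ([m+n]%n≡m%n l p)

  rectSides-α<l : ∀ {α l} → α + 1 ≤ l → 2 * l < p + 1 + α → RectSides α l (l ∸ α)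
  rectSides-α<l {α} {l} α+1≤l 2l<p+1+α =
    ≤-trans (s≤s z≤n) α<l , <⇒≤ l<p , ≤-<-trans (m∸n≤m l α) l<p , t≤p∸l , t+α≡l
    where
    α<l : α < l
    α<l = subst (_≤ l) (+-comm α 1) α+1≤l
    l+l≤p+α : l + l ≤ p + α
    l+l≤p+α = ≤-pred (subst₂ _≤_ (cong (λ n → suc (l + n)) (+-identityʳ l)) (cong (_+ α) (+-comm p 1)) 2l<p+1+α)
    l<p : l < p
    l<p = +-cancelʳ-< l l p (≤-<-trans l+l≤p+α (+-monoʳ-< p α<l))
    t≤p∸l : l ∸ α ≤ p ∸ l
    t≤p∸l = begin
      l ∸ α               ≡⟨ [m+n]∸[m+o]≡n∸o l l α ⟨
      (l + l) ∸ (l + α)   ≤⟨ ∸-monoˡ-≤ (l + α) l+l≤p+α ⟩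
      (p + α) ∸ (l + α)   ≡⟨ cong₂ _∸_ (+-comm p α) (+-comm l α) ⟩
      (α + p) ∸ (α + l)   ≡⟨ [m+n]∸[m+o]≡n∸o α p l ⟩
      p ∸ l               ∎
      where open ≤-Reasoning
    t+α≡l : (l ∸ α + α) % p ≡ l % p
    t+α≡l = cong (_% p) (m∸n+n≡m (<⇒≤ α<l))

open import Data.Integer using (+_)

theorem3p5 : (p : ℕ) → 2 ≤ p → (λ′ : Partition) → (α : ℕ) → α < p →
    IsJSOfType p λ′ (+ α) →
    (∃[ μ ] (IsCoreOf p λ′ μ ×
        (μ ≡ [] ⊎ ∃[ l ] ∃[ a ] (μ ≡ rect l a × ((+ l ℤ.- + a) ≡ + α [mod p ])))))
    × (∀ (x y : ℤ) → last (residueSymbol p λ′) ≡ just (x , y) →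
        ((l : ℕ) → 1 ≤ l → 2 * l ≤ α → InSetL p (+ α) (+ l) (x , y) →
          IsCoreOf p λ′ (rect l (p + l ∸ α)))
        × ((l : ℕ) → α + 1 ≤ l → 2 * l < p + 1 + α → InSetL p (+ α) (+ l) (x , y) →
          IsCoreOf p λ′ (rect l (l ∸ α)))
        × (InSetL p (+ α) (+ 0) (x , y) → IsCoreOf p λ′ []))
theorem3p5 zero () _ _ _ _
theorem3p5 p@(suc _) _ λ′ α α<p js =
  (_ , isCore , inj₂ (_ , _ , refl , core-type p C)) ,
  λ x y last≡ →
    let y≡ = residueSymbol-last p λ′ (proj₂ (isJS⇒isPartition js)) last≡ in
      (λ l 1≤l 2l≤α → core-rect p C x (rectSides-2l≤α p α<p 1≤l 2l≤α) y≡)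
    , (λ l α+1≤l 2l<p+1+α → core-rect p C x (rectSides-α<l p α+1≤l 2l<p+1+α) y≡)
    , core-empty p C x y≡
  where
  C = jsCore p λ′ α js
  open RectangularCore C
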